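{- For every integer $n\ge 0$, \[ \sum_{k=0}^{n}\big(f_2^{(2n-k,k)}\big)^2=\binom{2n}{n},\qquad \sum_{k=1}^{\lfloor n/2\rfloor}\big(f_2^{(2n-2k,2k-1,1)}\big)^2=\frac{1}{n+1}\binom{2n}{n}-1. \]
   Context: For a partition $\lambda$ of $2n$, a standard domino tableau of shape $\lambda$ is a tiling of the Young diagram of $\lambda$ by $n$ dominoes ($1\times2$ or $2\times1$ rectangles) labelled bijectively by $1,\dots,n$ so that labels (read cell by cell) strictly increase along rows from left to right and along columns from top to bottom. $f_2^\lambda$ denotes the number of standard domino tableaux of shape $\lambda$ (zero if none exist). -}

module Defs where

open import Data.Nat using (ℕ; zero; suc; _+_; _*_; _∸_; _≤ᵇ_; _≡ᵇ_; _/_)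
open import Data.Bool using (Bool; true; false; _∧_; _∨_; if_then_else_)
open import Data.List using (List; []; _∷_; map; concatMap; length; filter; upTo; _++_)
open import Data.Nat.ListAction using (sum)
open import Data.Product using (_×_; _,_)
open import Relation.Nullary.Decidable using (Dec)
open import Data.Bool.Properties using (T?)

-- A shape (Young diagram) is given by its list of row lengths (top to bottom).
Shape : Set
Shape = List ℕ

-- A filling of a shape: one list of labels per row (row i has length λ_i).
Filling : Set
Filling = List (List ℕ)

and : List Bool → Bool
and []       = true
and (b ∷ bs) = b ∧ and bs

lists : ℕ → ℕ → List (List ℕ)
lists zero    m = [] ∷ []
lists (suc r) m = concatMap (λ x → map (x ∷_) (lists r m)) (map suc (upTo m))

fillings : Shape → ℕ → List Filling
fillings []       m = [] ∷ []
fillings (r ∷ λ') m = concatMap (λ row → map (row ∷_) (fillings λ' m)) (lists r m)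

rowMono : List ℕ → Bool
rowMono (x ∷ y ∷ xs) = (x ≤ᵇ y) ∧ rowMono (y ∷ xs)
rowMono _ = true

colPair : List ℕ → List ℕ → Bool
colPair (x ∷ xs) (y ∷ ys) = (x ≤ᵇ y) ∧ colPair xs ys
colPair _ _ = true

colMono : Filling → Bool
colMono (r ∷ s ∷ rs) = colPair r s ∧ colMono (s ∷ rs)
colMono _ = true

indexed : ℕ → List ℕ → List (ℕ × ℕ)
indexed k []       = []
indexed k (x ∷ xs) = (k , x) ∷ indexed (suc k) xs

cellsWith : ℕ → Filling → List (ℕ × ℕ)
cellsWith ℓ T = go 0 T
  where
  go : ℕ → Filling → List (ℕ × ℕ)
  go i []       = []
  go i (r ∷ rs) = concatMap (λ p → sel i p) (indexed 0 r) ++ go (suc i) rs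
    where
    sel : ℕ → ℕ × ℕ → List (ℕ × ℕ)
    sel i (j , x) = if x ≡ᵇ ℓ then (i , j) ∷ [] else []

isDomino : List (ℕ × ℕ) → Bool
isDomino ((a , b) ∷ (c , d) ∷ []) =
  ((a ≡ᵇ c) ∧ (d ≡ᵇ suc b)) ∨ ((b ≡ᵇ d) ∧ (c ≡ᵇ suc a))
isDomino _ = false

-- A filling of λ by labels 1..n is a standard domino tableau iff each label
-- 1..n occupies exactly one domino, and labels weakly increase along rows and
-- columns (cell by cell); since the two cells of a domino share a label, this
-- is exactly strict increase between distinct dominoes.
isSDT : ℕ → Filling → Bool
isSDT n T = and (map (λ ℓ → isDomino (cellsWith ℓ T)) (map suc (upTo n)))
          ∧ and (map rowMono T) ∧ colMono T

-- f₂^λ : number of standard domino tableaux of shape λ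
-- (n = |λ|/2 dominoes; if |λ| is odd no filling qualifies, so f₂ = 0)
f₂ : Shape → ℕ
f₂ λ' = length (filter (λ T → T? (isSDT n T)) (fillings λ' n))
  where n = sum λ' / 2

-- The cells carrying the largest label of a standard domino tableau form a domino whose removal
-- leaves a standard domino tableau of a smaller shape, so f₂ of a shape is the sum of f₂ over the shapes obtained
-- by removing such a domino. For two rows this recursion is Pascal's rule and f₂^(2n−k,k) = C(n, ⌊k/2⌋);
-- pairing k = 2j, 2j + 1 and using C(n, j) = C(n, n − j), the first sum becomes Σ_j C(n, j)² = C(2n, n).
-- For the shapes (2n − 2i, 2i − 1, 1) the recursion gives f₂ = C(m, i) − C(m, i − 2) with m = n − 1. The numbers
-- g_i = |C(m, i) − C(m, i − 2)| are symmetric under i ↦ m + 2 − i with vanishing middle term, and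
-- |a − b|² = a² + b² − 2ab with Vandermonde's identity gives Σ_i g_i² = 2 (C(2m, m) − C(2m, m + 2)). Half of this
-- sum is g_0² = 1 plus the second sum, and (m + 2)(C(2m, m) − C(2m, m + 2)) = C(2m + 2, m + 1).

module Submission where

open import Defs
open import Data.Bool using (Bool; true; false; _∧_; _∨_; if_then_else_)
open import Data.Bool.Properties using (T?; T-≡; ∧-assoc; ∧-identityʳ; ∧-zeroʳ; ∨-zeroʳ; ∧-commutativeMonoid)
open import Algebra.Bundles using (CommutativeMonoid)
open import Algebra.Properties.CommutativeSemigroup (CommutativeMonoid.commutativeSemigroup ∧-commutativeMonoid)
  using () renaming (interchange to ∧-interchange)
open import Data.Empty using (⊥-elim)
open import Data.List
  using (List; []; _∷_; _++_; map; concatMap; length; filter; upTo; applyUpTo; replicate; cartesianProductWith)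
open import Data.List.Properties
  using (length-++; length-map; length-replicate; map-cong; map-++; map-∘; ∷-injective; ++-cancelʳ; upTo-∷ʳ)
open import Data.List.Membership.Propositional using (_∈_; find)
open import Data.List.Membership.Propositional.Properties
  using (∈-map⁺; ∈-map⁻; ∈-upTo⁺; ∈-upTo⁻; ∈-concatMap⁺; ∈-concatMap⁻; ∈-filter⁺; ∈-filter⁻;
         ∈-cartesianProductWith⁺; ∈-cartesianProductWith⁻)
open import Data.List.Membership.Propositional.Properties.WithK using (unique∧set⇒bag)
open import Data.List.Relation.Binary.BagAndSetEquality using (∼bag⇒↭)
open import Data.List.Relation.Binary.Permutation.Propositional.Properties using (↭-length)
open import Data.List.Relation.Unary.All as All using (All; []; _∷_)
import Data.List.Relation.Unary.All.Properties as All
open import Data.List.Relation.Unary.Any as Any using (here; there)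
open import Data.List.Relation.Unary.AllPairs using ([]; _∷_)
open import Data.List.Relation.Unary.Unique.Propositional using (Unique)
import Data.List.Relation.Unary.Unique.Propositional.Properties as Unique
open import Data.Nat
open import Data.Nat.ListAction using (sum)
open import Data.Nat.Combinatorics using (_C_; nCk+nC[k+1]≡[n+1]C[k+1]; nCk≡nC[n∸k])
open import Data.Nat.Combinatorics.Specification using (k>n⇒nCk≡0)
open import Data.Nat.DivMod using (m*n/n≡m; m/n≡1+[m∸n]/n)
open import Data.Nat.Tactic.RingSolver using (solve-∀)
open import Data.Nat.Properties
open import Data.Product using (∃₂; _×_; _,_; proj₁; proj₂)
open import Data.Sum using (inj₁; inj₂)
open import Function using (_∘_; id; mk⇔; Equivalence)
open import Relation.Binary.PropositionalEquality
open import Relation.Nullary using (¬_)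

private variable
  A B : Set

prependEach : List A → List (List A) → List (List A)
prependEach xs yss = concatMap (λ x → map (x ∷_) yss) xs

prependEach≡cartesianProductWith : (xs : List A) (yss : List (List A)) →
  prependEach xs yss ≡ cartesianProductWith _∷_ xs yss
prependEach≡cartesianProductWith []       yss = refl
prependEach≡cartesianProductWith (x ∷ xs) yss =
  cong (map (x ∷_) yss ++_) (prependEach≡cartesianProductWith xs yss)

∈-prependEach⁺ : ∀ {x ys} {xs : List A} {yss} → x ∈ xs → ys ∈ yss → x ∷ ys ∈ prependEach xs yss
∈-prependEach⁺ {xs = xs} {yss} x∈ ys∈ =
  subst (_ ∈_) (sym (prependEach≡cartesianProductWith xs yss)) (∈-cartesianProductWith⁺ _∷_ x∈ ys∈)

∈-prependEach⁻ : ∀ {zs} (xs : List A) yss → zs ∈ prependEach xs yss →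
  ∃₂ λ x ys → x ∈ xs × ys ∈ yss × zs ≡ x ∷ ys
∈-prependEach⁻ xs yss zs∈ =
  ∈-cartesianProductWith⁻ _∷_ xs yss (subst (_ ∈_) (prependEach≡cartesianProductWith xs yss) zs∈)

prependEach-unique : ∀ {xs : List A} {yss} → Unique xs → Unique yss → Unique (prependEach xs yss)
prependEach-unique {xs = xs} {yss} xs! yss! =
  subst Unique (sym (prependEach≡cartesianProductWith xs yss))
    (Unique.cartesianProductWith⁺ _∷_ ∷-injective xs! yss!)

words : List A → ℕ → List (List A)
words xs zero    = [] ∷ []
words xs (suc k) = prependEach xs (words xs k)

∈-words⁺ : ∀ {xs : List A} {ws} k → length ws ≡ k → All (_∈ xs) ws → ws ∈ words xs k
∈-words⁺ zero    refl []          = here refl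
∈-words⁺ (suc k) refl (w∈ ∷ ws∈) = ∈-prependEach⁺ w∈ (∈-words⁺ k refl ws∈)

∈-words⁻ : ∀ (xs : List A) {ws} k → ws ∈ words xs k → length ws ≡ k × All (_∈ xs) ws
∈-words⁻ xs zero    (here refl) = refl , []
∈-words⁻ xs (suc k) ws∈ with ∈-prependEach⁻ xs (words xs k) ws∈
... | w , vs , w∈ , vs∈ , refl with ∈-words⁻ xs k vs∈
...   | refl , vs⊆ = refl , w∈ ∷ vs⊆

words-unique : ∀ {xs : List A} k → Unique xs → Unique (words xs k)
words-unique zero    xs! = [] ∷ []
words-unique (suc k) xs! = prependEach-unique xs! (words-unique k xs!)

length-unique-cong : {xs ys : List A} → Unique xs → Unique ys →
  (∀ {z} → z ∈ xs → z ∈ ys) → (∀ {z} → z ∈ ys → z ∈ xs) → length xs ≡ length ys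
length-unique-cong xs! ys! xs⊆ys ys⊆xs =
  ↭-length (∼bag⇒↭ (unique∧set⇒bag xs! ys! (mk⇔ xs⊆ys ys⊆xs)))

length-concatMap : (f : A → List B) (xs : List A) → length (concatMap f xs) ≡ sum (map (length ∘ f) xs)
length-concatMap f []       = refl
length-concatMap f (x ∷ xs) = trans (length-++ (f x)) (cong (length (f x) +_) (length-concatMap f xs))

concatMap-unique : (key : B → A) (f : A → List B) {xs : List A} → Unique xs → (∀ x → Unique (f x)) →
  (∀ {x y} → x ∈ xs → y ∈ f x → key y ≡ x) → Unique (concatMap f xs)
concatMap-unique key f {[]}     _             _  _     = []
concatMap-unique key f {x ∷ xs} (x∉xs ∷ xs!) f! keyed =
  Unique.++⁺ (f! x) (concatMap-unique key f xs! f! (keyed ∘ there)) disjoint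
  where
  disjoint : ∀ {v} → ¬ (v ∈ f x × v ∈ concatMap f xs)
  disjoint (v∈fx , v∈rest) with find (∈-concatMap⁻ f {xs = xs} v∈rest)
  ... | x′ , x′∈xs , v∈fx′ =
    All.lookup x∉xs (subst (_∈ xs) (trans (sym (keyed (there x′∈xs) v∈fx′)) (keyed (here refl) v∈fx)) x′∈xs)
               refl

map-cong-∈ : (f g : A → B) (xs : List A) → (∀ {x} → x ∈ xs → f x ≡ g x) → map f xs ≡ map g xs
map-cong-∈ f g []       f≗g = refl
map-cong-∈ f g (x ∷ xs) f≗g = cong₂ _∷_ (f≗g (here refl)) (map-cong-∈ f g xs (f≗g ∘ there))

filter-cong-∈ : (p q : A → Bool) (xs : List A) → (∀ {x} → x ∈ xs → p x ≡ q x) →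
  filter (λ x → T? (p x)) xs ≡ filter (λ x → T? (q x)) xs
filter-cong-∈ p q []       p≗q = refl
filter-cong-∈ p q (x ∷ xs) p≗q rewrite p≗q (here refl) with q x
... | true  = cong (x ∷_) (filter-cong-∈ p q xs (p≗q ∘ there))
... | false = filter-cong-∈ p q xs (p≗q ∘ there)

∈⇒≤sum : ∀ {x} c → x ∈ c → x ≤ sum c
∈⇒≤sum (y ∷ ys) (here refl) = m≤m+n y (sum ys)
∈⇒≤sum (y ∷ ys) (there x∈) = ≤-trans (∈⇒≤sum ys x∈) (m≤n+m (sum ys) y)

≤2⇒∈012 : ∀ {x} → x ≤ 2 → x ∈ 0 ∷ 1 ∷ 2 ∷ []
≤2⇒∈012 z≤n             = here refl
≤2⇒∈012 (s≤s z≤n)       = there (here refl)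
≤2⇒∈012 (s≤s (s≤s z≤n)) = there (there (here refl))

≡ᵇ-refl : ∀ n → (n ≡ᵇ n) ≡ true
≡ᵇ-refl n = Equivalence.to T-≡ (≡⇒≡ᵇ n n refl)

≡ᵇ-true⇒≡ : ∀ {m n} → (m ≡ᵇ n) ≡ true → m ≡ n
≡ᵇ-true⇒≡ {m} {n} eq = ≡ᵇ⇒≡ m n (Equivalence.from T-≡ eq)

≢⇒≡ᵇ-false : ∀ {m n} → m ≢ n → (m ≡ᵇ n) ≡ false
≢⇒≡ᵇ-false {m} {n} m≢n with m ≡ᵇ n in eq
... | true  = ⊥-elim (m≢n (≡ᵇ-true⇒≡ eq))
... | false = refl

≡ᵇ-false⇒≢ : ∀ {m n} → (m ≡ᵇ n) ≡ false → m ≢ n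
≡ᵇ-false⇒≢ {m} eq refl with () ← trans (sym (≡ᵇ-refl m)) eq

≤⇒≤ᵇ-true : ∀ {m n} → m ≤ n → (m ≤ᵇ n) ≡ true
≤⇒≤ᵇ-true m≤n = Equivalence.to T-≡ (≤⇒≤ᵇ m≤n)

≤ᵇ-true⇒≤ : ∀ {m n} → (m ≤ᵇ n) ≡ true → m ≤ n
≤ᵇ-true⇒≤ {m} {n} eq = ≤ᵇ⇒≤ m n (Equivalence.from T-≡ eq)

≰⇒≤ᵇ-false : ∀ {m n} → ¬ m ≤ n → (m ≤ᵇ n) ≡ false
≰⇒≤ᵇ-false {m} {n} m≰n with m ≤ᵇ n in eq
... | true  = ⊥-elim (m≰n (≤ᵇ-true⇒≤ eq))
... | false = refl

suc≤ᵇsuc : ∀ m n → (suc m ≤ᵇ suc n) ≡ (m ≤ᵇ n)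
suc≤ᵇsuc zero    n = refl
suc≤ᵇsuc (suc m) n = refl

∧-true⁻ : ∀ {a b} → a ∧ b ≡ true → a ≡ true × b ≡ true
∧-true⁻ {true} {true} _ = refl , refl

and-++ : ∀ xs ys → and (xs ++ ys) ≡ and xs ∧ and ys
and-++ []       ys = refl
and-++ (x ∷ xs) ys = trans (cong (x ∧_) (and-++ xs ys)) (sym (∧-assoc x (and xs) (and ys)))

and-true⁻ : ∀ bs → and bs ≡ true → All (_≡ true) bs
and-true⁻ []       _  = []
and-true⁻ (b ∷ bs) eq = proj₁ (∧-true⁻ eq) ∷ and-true⁻ bs (proj₂ (∧-true⁻ eq))

Label : ℕ → ℕ → Set
Label m x = 1 ≤ x × x ≤ m

∈-labels⁺ : ∀ {m x} → Label m x → x ∈ map suc (upTo m)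
∈-labels⁺ {x = suc x} (_ , x<m) = ∈-map⁺ suc (∈-upTo⁺ x<m)

∈-labels⁻ : ∀ {m x} → x ∈ map suc (upTo m) → Label m x
∈-labels⁻ x∈ with ∈-map⁻ suc x∈
... | _ , i∈ , refl = s≤s z≤n , ∈-upTo⁻ i∈

lists≡words : ∀ r m → lists r m ≡ words (map suc (upTo m)) r
lists≡words zero    m = refl
lists≡words (suc r) m = cong (prependEach (map suc (upTo m))) (lists≡words r m)

∈-lists⁺ : ∀ r m {xs} → length xs ≡ r → All (Label m) xs → xs ∈ lists r m
∈-lists⁺ r m len labels =
  subst (_ ∈_) (sym (lists≡words r m)) (∈-words⁺ r len (All.map ∈-labels⁺ labels))

∈-lists⁻ : ∀ r m {xs} → xs ∈ lists r m → length xs ≡ r × All (Label m) xs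
∈-lists⁻ r m xs∈ with ∈-words⁻ _ r (subst (_ ∈_) (lists≡words r m) xs∈)
... | len , labels = len , All.map ∈-labels⁻ labels

labels-unique : ∀ m → Unique (map suc (upTo m))
labels-unique m = Unique.map⁺ suc-injective (Unique.upTo⁺ m)

∈-fillings⁺ : ∀ λ' m {T} → map length T ≡ λ' → All (All (Label m)) T → T ∈ fillings λ' m
∈-fillings⁺ []       m {[]}    refl []                  = here refl
∈-fillings⁺ (r ∷ λ') m {_ ∷ _} refl (row-ok ∷ rows-ok) =
  ∈-prependEach⁺ (∈-lists⁺ r m refl row-ok) (∈-fillings⁺ λ' m refl rows-ok)

∈-fillings⁻ : ∀ λ' m {T} → T ∈ fillings λ' m → map length T ≡ λ' × All (All (Label m)) T
∈-fillings⁻ []       m (here refl) = refl , []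
∈-fillings⁻ (r ∷ λ') m T∈ with ∈-prependEach⁻ (lists r m) (fillings λ' m) T∈
... | row , rows , row∈ , rows∈ , refl with ∈-lists⁻ r m row∈ | ∈-fillings⁻ λ' m rows∈
...   | refl , row-ok | refl , rows-ok = refl , row-ok ∷ rows-ok

fillings-unique : ∀ λ' m → Unique (fillings λ' m)
fillings-unique []       m = [] ∷ []
fillings-unique (r ∷ λ') m =
  prependEach-unique (subst Unique (sym (lists≡words r m)) (words-unique r (labels-unique m)))
                     (fillings-unique λ' m)

rowCells : ℕ → ℕ → ℕ → List ℕ → List (ℕ × ℕ)
rowCells ℓ i j []       = []
rowCells ℓ i j (x ∷ xs) = (if x ≡ᵇ ℓ then (i , j) ∷ [] else []) ++ rowCells ℓ i (suc j) xs

labelCells : ℕ → ℕ → Filling → List (ℕ × ℕ)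
labelCells ℓ i []       = []
labelCells ℓ i (r ∷ rs) = rowCells ℓ i 0 r ++ labelCells ℓ (suc i) rs

dominoes : ℕ → Filling → Bool
dominoes m T = and (map (λ ℓ → isDomino (labelCells ℓ 0 T)) (map suc (upTo m)))

isSDT′ : ℕ → Filling → Bool
isSDT′ m T = dominoes m T ∧ and (map rowMono T) ∧ colMono T

standardFillings : Shape → ℕ → List Filling
standardFillings λ' m = filter (λ T → T? (isSDT′ m T)) (fillings λ' m)

count : Shape → ℕ → ℕ
count λ' m = length (standardFillings λ' m)

∈-standardFillings⁻ : ∀ λ' m {T} → T ∈ standardFillings λ' m → T ∈ fillings λ' m × isSDT′ m T ≡ true
∈-standardFillings⁻ λ' m T∈ with ∈-filter⁻ (λ T → T? (isSDT′ m T)) {xs = fillings λ' m} T∈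
... | T∈fillings , standard = T∈fillings , Equivalence.to T-≡ standard

∈-standardFillings⁺ : ∀ λ' m {T} → T ∈ fillings λ' m → isSDT′ m T ≡ true → T ∈ standardFillings λ' m
∈-standardFillings⁺ λ' m T∈ standard = ∈-filter⁺ (λ T → T? (isSDT′ m T)) T∈ (Equivalence.from T-≡ standard)

concatMap-indexed : ∀ ℓ i (select : ℕ × ℕ → List (ℕ × ℕ)) →
  (∀ j x → select (j , x) ≡ (if x ≡ᵇ ℓ then (i , j) ∷ [] else [])) →
  ∀ j r → concatMap select (indexed j r) ≡ rowCells ℓ i j r
concatMap-indexed ℓ i select selects j []       = refl
concatMap-indexed ℓ i select selects j (x ∷ xs) =
  cong₂ _++_ (selects j x) (concatMap-indexed ℓ i select selects (suc j) xs)

-- The row loop of cellsWith is local to Defs, so it can only be unfolded on fillings of known height.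
cellsWith-2rows : ∀ ℓ r₀ r₁ → cellsWith ℓ (r₀ ∷ r₁ ∷ []) ≡ labelCells ℓ 0 (r₀ ∷ r₁ ∷ [])
cellsWith-2rows ℓ r₀ r₁ =
  cong₂ _++_ (concatMap-indexed ℓ 0 _ (λ _ _ → refl) 0 r₀)
             (cong (_++ []) (concatMap-indexed ℓ 1 _ (λ _ _ → refl) 0 r₁))

cellsWith-3rows : ∀ ℓ r₀ r₁ r₂ →
  cellsWith ℓ (r₀ ∷ r₁ ∷ r₂ ∷ []) ≡ labelCells ℓ 0 (r₀ ∷ r₁ ∷ r₂ ∷ [])
cellsWith-3rows ℓ r₀ r₁ r₂ =
  cong₂ _++_ (concatMap-indexed ℓ 0 _ (λ _ _ → refl) 0 r₀)
    (cong₂ _++_ (concatMap-indexed ℓ 1 _ (λ _ _ → refl) 0 r₁)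
                (cong (_++ []) (concatMap-indexed ℓ 2 _ (λ _ _ → refl) 0 r₂)))

f₂≡count : ∀ λ' → (∀ ℓ {T} → map length T ≡ λ' → cellsWith ℓ T ≡ labelCells ℓ 0 T) →
  f₂ λ' ≡ count λ' (sum λ' / 2)
f₂≡count λ' cells≡ = cong length (filter-cong-∈ (isSDT m) (isSDT′ m) (fillings λ' m) agree)
  where
  m = sum λ' / 2
  agree : ∀ {T} → T ∈ fillings λ' m → isSDT m T ≡ isSDT′ m T
  agree {T} T∈ = cong (_∧ and (map rowMono T) ∧ colMono T)
    (cong and (map-cong (λ ℓ → cong isDomino (cells≡ ℓ (proj₁ (∈-fillings⁻ λ' m T∈)))) (map suc (upTo m))))

f₂≡count-2rows : ∀ a b → f₂ (a ∷ b ∷ []) ≡ count (a ∷ b ∷ []) ((a + (b + 0)) / 2)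
f₂≡count-2rows a b = f₂≡count (a ∷ b ∷ []) λ { ℓ {r₀ ∷ r₁ ∷ []} _ → cellsWith-2rows ℓ r₀ r₁ }

f₂≡count-3rows : ∀ a b c → f₂ (a ∷ b ∷ c ∷ []) ≡ count (a ∷ b ∷ c ∷ []) ((a + (b + (c + 0))) / 2)
f₂≡count-3rows a b c =
  f₂≡count (a ∷ b ∷ c ∷ []) λ { ℓ {r₀ ∷ r₁ ∷ r₂ ∷ []} _ → cellsWith-3rows ℓ r₀ r₁ r₂ }

head₀ : List ℕ → ℕ
head₀ []      = 0
head₀ (x ∷ _) = x

tail₀ : List ℕ → List ℕ
tail₀ []       = []
tail₀ (_ ∷ xs) = xs

padRow : ℕ → List ℕ → ℕ → List ℕ
padRow N r k = r ++ replicate k N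

pad : ℕ → Filling → List ℕ → Filling
pad N []      c = []
pad N (r ∷ T) c = padRow N r (head₀ c) ∷ pad N T (tail₀ c)

dropLabel : ℕ → List ℕ → List ℕ
dropLabel N []       = []
dropLabel N (x ∷ xs) = if x ≡ᵇ N then dropLabel N xs else x ∷ dropLabel N xs

countLabel : ℕ → List ℕ → ℕ
countLabel N []       = 0
countLabel N (x ∷ xs) = if x ≡ᵇ N then suc (countLabel N xs) else countLabel N xs

rowMono-tail : ∀ x xs → rowMono (x ∷ xs) ≡ true → rowMono xs ≡ true
rowMono-tail x []       _    = refl
rowMono-tail x (y ∷ ys) mono = proj₂ (∧-true⁻ mono)

rowMono-head : ∀ x y ys → rowMono (x ∷ y ∷ ys) ≡ true → x ≤ y
rowMono-head x y ys mono = ≤ᵇ-true⇒≤ (proj₁ (∧-true⁻ mono))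

rowMono-top : ∀ N xs → rowMono (N ∷ xs) ≡ true → All (_≤ N) xs → xs ≡ replicate (length xs) N
rowMono-top N []       _    _              = refl
rowMono-top N (y ∷ ys) mono (y≤N ∷ ys≤N) with ≤-antisym y≤N (rowMono-head N y ys mono)
... | refl = cong (N ∷_) (rowMono-top N ys (rowMono-tail N (N ∷ ys) mono) ys≤N)

dropLabel-replicate : ∀ N k → dropLabel N (replicate k N) ≡ []
dropLabel-replicate N zero    = refl
dropLabel-replicate N (suc k) rewrite ≡ᵇ-refl N = dropLabel-replicate N k

countLabel-replicate : ∀ N k → countLabel N (replicate k N) ≡ k
countLabel-replicate N zero    = refl
countLabel-replicate N (suc k) rewrite ≡ᵇ-refl N = cong suc (countLabel-replicate N k)

padRow-split : ∀ N r → rowMono r ≡ true → All (_≤ N) r → r ≡ padRow N (dropLabel N r) (countLabel N r)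
padRow-split N []       _    _              = refl
padRow-split N (x ∷ xs) mono (x≤N ∷ xs≤N) with x ≡ᵇ N in x≡ᵇN
... | false = cong (x ∷_) (padRow-split N xs (rowMono-tail x xs mono) xs≤N)
... | true with ≡ᵇ-true⇒≡ {x} x≡ᵇN
...   | refl rewrite rowMono-top N xs mono xs≤N
                   | dropLabel-replicate N (length xs) | countLabel-replicate N (length xs) = refl

dropLabel-padRow : ∀ N r k → All (_≢ N) r → dropLabel N (padRow N r k) ≡ r
dropLabel-padRow N []       k _              = dropLabel-replicate N k
dropLabel-padRow N (x ∷ xs) k (x≢N ∷ xs≢N) rewrite ≢⇒≡ᵇ-false x≢N =
  cong (x ∷_) (dropLabel-padRow N xs k xs≢N)

countLabel-padRow : ∀ N r k → All (_≢ N) r → countLabel N (padRow N r k) ≡ k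
countLabel-padRow N []       k _              = countLabel-replicate N k
countLabel-padRow N (x ∷ xs) k (x≢N ∷ xs≢N) rewrite ≢⇒≡ᵇ-false x≢N = countLabel-padRow N xs k xs≢N

length-dropLabel : ∀ N r → length (dropLabel N r) + countLabel N r ≡ length r
length-dropLabel N []       = refl
length-dropLabel N (x ∷ xs) with x ≡ᵇ N
... | true  = trans (+-suc _ _) (cong suc (length-dropLabel N xs))
... | false = cong suc (length-dropLabel N xs)

countLabel≤length : ∀ N r → countLabel N r ≤ length r
countLabel≤length N r = subst (countLabel N r ≤_) (length-dropLabel N r) (m≤n+m _ _)

dropLabel-all : ∀ {P : ℕ → Set} N r → All P r → All P (dropLabel N r)
dropLabel-all N []       _          = []
dropLabel-all N (x ∷ xs) (px ∷ pxs) with x ≡ᵇ N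
... | true  = dropLabel-all N xs pxs
... | false = px ∷ dropLabel-all N xs pxs

dropLabel-≢ : ∀ N r → All (_≢ N) (dropLabel N r)
dropLabel-≢ N []       = []
dropLabel-≢ N (x ∷ xs) with x ≡ᵇ N in x≡ᵇN
... | true  = dropLabel-≢ N xs
... | false = ≡ᵇ-false⇒≢ x≡ᵇN ∷ dropLabel-≢ N xs

rowMono-replicate : ∀ N k → rowMono (replicate k N) ≡ true
rowMono-replicate N zero          = refl
rowMono-replicate N (suc zero)    = refl
rowMono-replicate N (suc (suc k)) =
  cong₂ _∧_ (≤⇒≤ᵇ-true (≤-refl {N})) (rowMono-replicate N (suc k))

rowMono-padRow : ∀ N r k → All (_≤ N) r → rowMono (padRow N r k) ≡ rowMono r
rowMono-padRow N []           k       _           = rowMono-replicate N k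
rowMono-padRow N (x ∷ [])     zero    _           = refl
rowMono-padRow N (x ∷ [])     (suc k) (x≤N ∷ _) rewrite ≤⇒≤ᵇ-true x≤N = rowMono-replicate N (suc k)
rowMono-padRow N (x ∷ y ∷ ys) k       (_ ∷ ys≤N) = cong ((x ≤ᵇ y) ∧_) (rowMono-padRow N (y ∷ ys) k ys≤N)

rowCells-replicate-other : ∀ ℓ N i j k → ℓ ≢ N → rowCells ℓ i j (replicate k N) ≡ []
rowCells-replicate-other ℓ N i j zero    ℓ≢N = refl
rowCells-replicate-other ℓ N i j (suc k) ℓ≢N rewrite ≢⇒≡ᵇ-false (ℓ≢N ∘ sym) =
  rowCells-replicate-other ℓ N i (suc j) k ℓ≢N

rowCells-padRow-other : ∀ ℓ N i j r k → ℓ ≢ N → rowCells ℓ i j (padRow N r k) ≡ rowCells ℓ i j r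
rowCells-padRow-other ℓ N i j []       k ℓ≢N = rowCells-replicate-other ℓ N i j k ℓ≢N
rowCells-padRow-other ℓ N i j (x ∷ xs) k ℓ≢N =
  cong ((if x ≡ᵇ ℓ then (i , j) ∷ [] else []) ++_) (rowCells-padRow-other ℓ N i (suc j) xs k ℓ≢N)

labelCells-pad-other : ∀ ℓ N i T c → ℓ ≢ N → labelCells ℓ i (pad N T c) ≡ labelCells ℓ i T
labelCells-pad-other ℓ N i []      c ℓ≢N = refl
labelCells-pad-other ℓ N i (r ∷ T) c ℓ≢N =
  cong₂ _++_ (rowCells-padRow-other ℓ N i 0 r (head₀ c) ℓ≢N)
             (labelCells-pad-other ℓ N (suc i) T (tail₀ c) ℓ≢N)

run : ℕ → ℕ → ℕ → List (ℕ × ℕ)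
run i j zero    = []
run i j (suc k) = (i , j) ∷ run i (suc j) k

padCells : ℕ → List ℕ → List ℕ → List (ℕ × ℕ)
padCells i []       c = []
padCells i (l ∷ ls) c = run i l (head₀ c) ++ padCells (suc i) ls (tail₀ c)

rowCells-replicate : ∀ N i j k → rowCells N i j (replicate k N) ≡ run i j k
rowCells-replicate N i j zero    = refl
rowCells-replicate N i j (suc k) rewrite ≡ᵇ-refl N = cong ((i , j) ∷_) (rowCells-replicate N i (suc j) k)

rowCells-padRow : ∀ N i j r k → All (_≢ N) r → rowCells N i j (padRow N r k) ≡ run i (j + length r) k
rowCells-padRow N i j []       k _              =
  trans (rowCells-replicate N i j k) (cong (λ l → run i l k) (sym (+-identityʳ j)))
rowCells-padRow N i j (x ∷ xs) k (x≢N ∷ xs≢N) rewrite ≢⇒≡ᵇ-false x≢N =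
  trans (rowCells-padRow N i (suc j) xs k xs≢N) (cong (λ l → run i l k) (sym (+-suc j (length xs))))

labelCells-pad : ∀ N i T c → All (All (_≢ N)) T → labelCells N i (pad N T c) ≡ padCells i (map length T) c
labelCells-pad N i []      c _              = refl
labelCells-pad N i (r ∷ T) c (r≢N ∷ T≢N) =
  cong₂ _++_ (rowCells-padRow N i 0 r (head₀ c) r≢N) (labelCells-pad N (suc i) T (tail₀ c) T≢N)

dominoes-suc : ∀ m T → dominoes (suc m) T ≡ dominoes m T ∧ isDomino (labelCells (suc m) 0 T)
dominoes-suc m T = begin
  dominoes (suc m) T
    ≡⟨ cong (λ ls → and (map domino (map suc ls))) (sym (upTo-∷ʳ m)) ⟩
  and (map domino (map suc (upTo m ++ m ∷ [])))
    ≡⟨ cong (λ ds → and (map domino ds)) (map-++ suc (upTo m) (m ∷ [])) ⟩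
  and (map domino (map suc (upTo m) ++ suc m ∷ []))
    ≡⟨ cong and (map-++ domino (map suc (upTo m)) (suc m ∷ [])) ⟩
  and (map domino (map suc (upTo m)) ++ domino (suc m) ∷ [])
    ≡⟨ trans (and-++ (map domino (map suc (upTo m))) _) (cong (dominoes m T ∧_) (∧-identityʳ _)) ⟩
  dominoes m T ∧ domino (suc m) ∎
  where
  open ≡-Reasoning
  domino : ℕ → Bool
  domino ℓ = isDomino (labelCells ℓ 0 T)

dominoes-pad : ∀ m T c → dominoes m (pad (suc m) T c) ≡ dominoes m T
dominoes-pad m T c = cong and (map-cong-∈ _ _ (map suc (upTo m))
  λ ℓ∈ → cong isDomino (labelCells-pad-other _ (suc m) 0 T c (<⇒≢ (s≤s (proj₂ (∈-labels⁻ ℓ∈))))))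

colPair-replicate : ∀ N r k → All (_≤ N) r → colPair r (replicate k N) ≡ true
colPair-replicate N []       k       _              = refl
colPair-replicate N (x ∷ xs) zero    _              = refl
colPair-replicate N (x ∷ xs) (suc k) (x≤N ∷ xs≤N) rewrite ≤⇒≤ᵇ-true x≤N = colPair-replicate N xs k xs≤N

padRow-≤ : ∀ N r k → All (_≤ N) r → All (_≤ N) (padRow N r k)
padRow-≤ N []       zero    _              = []
padRow-≤ N []       (suc k) _              = ≤-refl ∷ padRow-≤ N [] k []
padRow-≤ N (x ∷ xs) k       (x≤N ∷ xs≤N) = x≤N ∷ padRow-≤ N xs k xs≤N

colPair-padRow : ∀ N r s k k′ → All (_≤ N) r → All (_< N) s →
  colPair (padRow N r k) (padRow N s k′) ≡ colPair r s ∧ ((k ≡ᵇ 0) ∨ (length s ≤ᵇ length r))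
colPair-padRow N []       []       k       k′ _              _              =
  trans (colPair-replicate N (replicate k N) k′ (padRow-≤ N [] k [])) (sym (∨-zeroʳ (k ≡ᵇ 0)))
colPair-padRow N []       (y ∷ ys) zero    k′ _              _              = refl
colPair-padRow N []       (y ∷ ys) (suc k) k′ _              (y<N ∷ _) rewrite ≰⇒≤ᵇ-false (<⇒≱ y<N) = refl
colPair-padRow N (x ∷ xs) []       k       k′ r≤N            _              =
  trans (colPair-replicate N (padRow N (x ∷ xs) k) k′ (padRow-≤ N (x ∷ xs) k r≤N)) (sym (∨-zeroʳ (k ≡ᵇ 0)))
colPair-padRow N (x ∷ xs) (y ∷ ys) k       k′ (_ ∷ xs≤N) (_ ∷ ys<N) = begin
  (x ≤ᵇ y) ∧ colPair (padRow N xs k) (padRow N ys k′)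
    ≡⟨ cong ((x ≤ᵇ y) ∧_) (colPair-padRow N xs ys k k′ xs≤N ys<N) ⟩
  (x ≤ᵇ y) ∧ (colPair xs ys ∧ ((k ≡ᵇ 0) ∨ (length ys ≤ᵇ length xs)))
    ≡⟨ sym (∧-assoc (x ≤ᵇ y) (colPair xs ys) _) ⟩
  ((x ≤ᵇ y) ∧ colPair xs ys) ∧ ((k ≡ᵇ 0) ∨ (length ys ≤ᵇ length xs))
    ≡⟨ cong (λ b → ((x ≤ᵇ y) ∧ colPair xs ys) ∧ ((k ≡ᵇ 0) ∨ b))
            (sym (suc≤ᵇsuc (length ys) (length xs))) ⟩
  ((x ≤ᵇ y) ∧ colPair xs ys) ∧ ((k ≡ᵇ 0) ∨ (suc (length ys) ≤ᵇ suc (length xs))) ∎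
  where open ≡-Reasoning

-- Cells padded onto row i must have no cell of μ below them: c_i = 0 or μ_{i+1} ≤ μ_i.
nothingBelowPads : List ℕ → List ℕ → Bool
nothingBelowPads (l₁ ∷ l₂ ∷ ls) c =
  ((head₀ c ≡ᵇ 0) ∨ (l₂ ≤ᵇ l₁)) ∧ nothingBelowPads (l₂ ∷ ls) (tail₀ c)
nothingBelowPads _              _ = true

colMono-pad : ∀ N T c → All (All (_< N)) T →
  colMono (pad N T c) ≡ colMono T ∧ nothingBelowPads (map length T) c
colMono-pad N []          c _                        = refl
colMono-pad N (r ∷ [])    c _                        = refl
colMono-pad N (r ∷ s ∷ T) c (r<N ∷ s<N ∷ T<N) =
  trans (cong₂ _∧_ (colPair-padRow N r s (head₀ c) (head₀ (tail₀ c)) (All.map <⇒≤ r<N) s<N)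
                   (colMono-pad N (s ∷ T) (tail₀ c) (s<N ∷ T<N)))
        (∧-interchange (colPair r s) _ (colMono (s ∷ T)) _)

rowMono-pad : ∀ N T c → All (All (_≤ N)) T → and (map rowMono (pad N T c)) ≡ and (map rowMono T)
rowMono-pad N []      c _              = refl
rowMono-pad N (r ∷ T) c (r≤N ∷ T≤N) =
  cong₂ _∧_ (rowMono-padRow N r (head₀ c) r≤N) (rowMono-pad N T (tail₀ c) T≤N)

isSDT′-pad : ∀ m T c → All (All (Label m)) T →
  isSDT′ (suc m) (pad (suc m) T c)
    ≡ isSDT′ m T ∧ (isDomino (padCells 0 (map length T) c) ∧ nothingBelowPads (map length T) c)
isSDT′-pad m T c labels = begin
  isSDT′ (suc m) (pad (suc m) T c)
    ≡⟨ cong₂ _∧_ (trans (dominoes-suc m (pad (suc m) T c))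
                        (cong₂ _∧_ (dominoes-pad m T c) (cong isDomino (labelCells-pad (suc m) 0 T c T≢N))))
                 (cong₂ _∧_ (rowMono-pad (suc m) T c T≤N) (colMono-pad (suc m) T c T<N)) ⟩
  (D ∧ P) ∧ (R ∧ (Col ∧ Below))
    ≡⟨ cong ((D ∧ P) ∧_) (sym (∧-assoc R Col Below)) ⟩
  (D ∧ P) ∧ ((R ∧ Col) ∧ Below)
    ≡⟨ ∧-interchange D P (R ∧ Col) Below ⟩
  (D ∧ (R ∧ Col)) ∧ (P ∧ Below) ∎
  where
  open ≡-Reasoning
  D = dominoes m T
  P = isDomino (padCells 0 (map length T) c)
  R = and (map rowMono T)
  Col = colMono T
  Below = nothingBelowPads (map length T) c
  T<N : All (All (_< suc m)) T
  T<N = All.map (All.map (s≤s ∘ proj₂)) labels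
  T≤N = All.map (All.map <⇒≤) T<N
  T≢N = All.map (All.map <⇒≢) T<N

-- Removing the largest domino

shrink : Shape → List ℕ → Shape
shrink []       c = []
shrink (l ∷ ls) c = (l ∸ head₀ c) ∷ shrink ls (tail₀ c)

fits : Shape → List ℕ → Bool
fits []       c = true
fits (l ∷ ls) c = (head₀ c ≤ᵇ l) ∧ fits ls (tail₀ c)

-- c gives, row by row, how many cells of λ' a domino carrying the largest label may occupy.
removable : Shape → List ℕ → Bool
removable λ' c = isDomino (padCells 0 (shrink λ' c) c) ∧ (fits λ' c ∧ nothingBelowPads (shrink λ' c) c)

dominoProfiles : ℕ → List (List ℕ)
dominoProfiles = words (0 ∷ 1 ∷ 2 ∷ [])

∈-dominoProfiles : ∀ {c} k → length c ≡ k → sum c ≡ 2 → c ∈ dominoProfiles k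
∈-dominoProfiles {c} k len sum≡2 =
  ∈-words⁺ k len (All.tabulate λ x∈ → ≤2⇒∈012 (subst (_ ≤_) sum≡2 (∈⇒≤sum c x∈)))

dominoProfiles-unique : ∀ k → Unique (dominoProfiles k)
dominoProfiles-unique k = words-unique k (((λ ()) ∷ (λ ()) ∷ []) ∷ ((λ ()) ∷ []) ∷ [] ∷ [])

length-shrink : ∀ ls c → length (shrink ls c) ≡ length ls
length-shrink []       c = refl
length-shrink (l ∷ ls) c = cong suc (length-shrink ls (tail₀ c))

pad-injective : ∀ N c {T T′} → pad N T c ≡ pad N T′ c → T ≡ T′
pad-injective N c {[]}    {[]}     _  = refl
pad-injective N c {r ∷ T} {r′ ∷ T′} eq with ∷-injective eq
... | r≡ , T≡ = cong₂ _∷_ (++-cancelʳ _ r r′ r≡) (pad-injective N (tail₀ c) T≡)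

countLabel-pad : ∀ N T c → length c ≡ length T → All (All (_≢ N)) T → map (countLabel N) (pad N T c) ≡ c
countLabel-pad N []      []      _   _              = refl
countLabel-pad N (r ∷ T) (k ∷ c) len (r≢N ∷ T≢N) =
  cong₂ _∷_ (countLabel-padRow N r k r≢N) (countLabel-pad N T c (suc-injective len) T≢N)

pad-split : ∀ N T → All (λ r → rowMono r ≡ true) T → All (All (_≤ N)) T →
  T ≡ pad N (map (dropLabel N) T) (map (countLabel N) T)
pad-split N []      _                  _              = refl
pad-split N (r ∷ T) (r-mono ∷ T-mono) (r≤N ∷ T≤N) =
  cong₂ _∷_ (padRow-split N r r-mono r≤N) (pad-split N T T-mono T≤N)

length-dropLabels : ∀ N T → map length (map (dropLabel N) T) ≡ shrink (map length T) (map (countLabel N) T)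
length-dropLabels N []      = refl
length-dropLabels N (r ∷ T) =
  cong₂ _∷_ (sym (trans (cong (_∸ countLabel N r) (sym (length-dropLabel N r))) (m+n∸n≡m _ (countLabel N r))))
            (length-dropLabels N T)

fits-countLabels : ∀ N T → fits (map length T) (map (countLabel N) T) ≡ true
fits-countLabels N []      = refl
fits-countLabels N (r ∷ T) rewrite ≤⇒≤ᵇ-true (countLabel≤length N r) = fits-countLabels N T

dropLabels-labels : ∀ m T → All (All (Label (suc m))) T → All (All (Label m)) (map (dropLabel (suc m)) T)
dropLabels-labels m []      _                  = []
dropLabels-labels m (r ∷ T) (r-labels ∷ T-labels) =
  All.map lower (All.zip (dropLabel-all (suc m) r r-labels , dropLabel-≢ (suc m) r)) ∷ dropLabels-labels m T T-labels
  where
  lower : ∀ {x} → Label (suc m) x × x ≢ suc m → Label m x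
  lower ((1≤x , x≤1+m) , x≢1+m) = 1≤x , ≤-pred (≤∧≢⇒< x≤1+m x≢1+m)

length-run : ∀ i j k → length (run i j k) ≡ k
length-run i j zero    = refl
length-run i j (suc k) = cong suc (length-run i (suc j) k)

length-padCells : ∀ i ls c → length ls ≡ length c → length (padCells i ls c) ≡ sum c
length-padCells i []       []      _   = refl
length-padCells i (l ∷ ls) (k ∷ c) len =
  trans (length-++ (run i l k)) (cong₂ _+_ (length-run i l k) (length-padCells (suc i) ls c (suc-injective len)))

isDomino⇒length≡2 : ∀ xs → isDomino xs ≡ true → length xs ≡ 2
isDomino⇒length≡2 (_ ∷ _ ∷ []) _ = refl

length-pad : ∀ N λ' T c → map length T ≡ shrink λ' c → fits λ' c ≡ true → map length (pad N T c) ≡ λ'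
length-pad N []       []      c _  _   = refl
length-pad N (l ∷ λ') (r ∷ T) c eq fit with ∷-injective eq | ∧-true⁻ {head₀ c ≤ᵇ l} fit
... | r-len , T-len | k≤l , fit′ =
  cong₂ _∷_ (trans (length-++ r) (trans (cong₂ _+_ r-len (length-replicate (head₀ c)))
                                         (m∸n+n≡m (≤ᵇ-true⇒≤ {head₀ c} k≤l))))
            (length-pad N λ' T (tail₀ c) T-len fit′)

padRow-labels : ∀ m r k → All (Label m) r → All (Label (suc m)) (padRow (suc m) r k)
padRow-labels m []       zero    _                        = []
padRow-labels m []       (suc k) _                        = (s≤s z≤n , ≤-refl) ∷ padRow-labels m [] k []
padRow-labels m (x ∷ xs) k       ((1≤x , x≤m) ∷ xs-labels) =
  (1≤x , m≤n⇒m≤1+n x≤m) ∷ padRow-labels m xs k xs-labels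

pad-labels : ∀ m T c → All (All (Label m)) T → All (All (Label (suc m))) (pad (suc m) T c)
pad-labels m []      c _                     = []
pad-labels m (r ∷ T) c (r-labels ∷ T-labels) =
  padRow-labels m r (head₀ c) r-labels ∷ pad-labels m T (tail₀ c) T-labels

when : Bool → ℕ → ℕ
when g n = if g then n else 0

padAll : Shape → ℕ → List ℕ → Bool → List Filling
padAll λ' m c true  = map (λ T → pad (suc m) T c) (standardFillings (shrink λ' c) m)
padAll λ' m c false = []

-- The standard fillings of λ' by 1 … m+1 whose label m+1 occupies the cells described by c.
withTopDomino : Shape → ℕ → List ℕ → List Filling
withTopDomino λ' m c = padAll λ' m c (removable λ' c)

length-padAll : ∀ λ' m c b → length (padAll λ' m c b) ≡ when b (count (shrink λ' c) m)
length-padAll λ' m c true  = length-map _ (standardFillings (shrink λ' c) m)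
length-padAll λ' m c false = refl

padAll-unique : ∀ λ' m c b → Unique (padAll λ' m c b)
padAll-unique λ' m c true  =
  Unique.map⁺ (pad-injective (suc m) c) (Unique.filter⁺ _ (fillings-unique (shrink λ' c) m))
padAll-unique λ' m c false = []

countLabels-padAll : ∀ λ' m c b → length c ≡ length λ' →
  ∀ {T} → T ∈ padAll λ' m c b → map (countLabel (suc m)) T ≡ c
countLabels-padAll λ' m c true len T∈ with ∈-map⁻ (λ T → pad (suc m) T c) T∈
... | T′ , T′∈ , refl with ∈-fillings⁻ (shrink λ' c) m (proj₁ (∈-standardFillings⁻ (shrink λ' c) m T′∈))
...   | T′-shape , T′-labels =
  countLabel-pad (suc m) T′ c
    (trans len (trans (sym (length-shrink λ' c)) (trans (cong length (sym T′-shape)) (length-map length T′))))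
    (All.map (All.map (<⇒≢ ∘ s≤s ∘ proj₂)) T′-labels)

padAll⊆standard : ∀ λ' m c b → removable λ' c ≡ b →
  ∀ {T} → T ∈ padAll λ' m c b → T ∈ standardFillings λ' (suc m)
padAll⊆standard λ' m c true rem T∈ with ∈-map⁻ (λ T → pad (suc m) T c) T∈
... | T′ , T′∈ , refl with ∈-standardFillings⁻ (shrink λ' c) m T′∈
...   | T′∈fillings , T′-standard with ∈-fillings⁻ (shrink λ' c) m T′∈fillings | ∧-true⁻ rem
...     | T′-shape , T′-labels | domino , fits-below with ∧-true⁻ fits-below
...       | fit , below =
  ∈-standardFillings⁺ λ' (suc m)
    (∈-fillings⁺ λ' (suc m) (length-pad (suc m) λ' T′ c T′-shape fit) (pad-labels m T′ c T′-labels))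
    (trans (isSDT′-pad m T′ c T′-labels)
           (cong₂ _∧_ T′-standard (cong₂ _∧_ (on-T′ (λ μ → isDomino (padCells 0 μ c)) domino)
                                             (on-T′ (λ μ → nothingBelowPads μ c) below))))
  where
  on-T′ : (P : Shape → Bool) → P (shrink λ' c) ≡ true → P (map length T′) ≡ true
  on-T′ P = subst (λ μ → P μ ≡ true) (sym T′-shape)

-- A standard filling T splits as pad (m+1) T′ c, with T′ its labels below m+1 and c the row counts of m+1.
standard⊆withTopDomino : ∀ λ' m {T} → T ∈ standardFillings λ' (suc m) →
  T ∈ concatMap (withTopDomino λ' m) (dominoProfiles (length λ'))
standard⊆withTopDomino λ' m {T} T∈ with ∈-standardFillings⁻ λ' (suc m) T∈
... | T∈fillings , standard with ∈-fillings⁻ λ' (suc m) T∈fillings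
...   | refl , labels =
  ∈-concatMap⁺ (withTopDomino λ' m) (Any.map (λ { refl → T∈block }) c∈profiles)
  where
  N = suc m
  c = map (countLabel N) T
  T′ = map (dropLabel N) T
  T′-labels : All (All (Label m)) T′
  T′-labels = dropLabels-labels m T labels
  split : T ≡ pad N T′ c
  rows-mono = proj₁ (∧-true⁻ (proj₂ (∧-true⁻ {dominoes N T} standard)))
  split = pad-split N T (All.map⁻ (and-true⁻ (map rowMono T) rows-mono)) (All.map (All.map proj₂) labels)
  T′-shape : map length T′ ≡ shrink λ' c
  T′-shape = length-dropLabels N T
  parts : isSDT′ m T′ ∧ (isDomino (padCells 0 (shrink λ' c) c) ∧ nothingBelowPads (shrink λ' c) c) ≡ true
  parts = subst (λ μ → isSDT′ m T′ ∧ (isDomino (padCells 0 μ c) ∧ nothingBelowPads μ c) ≡ true) T′-shape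
            (trans (sym (isSDT′-pad m T′ c T′-labels)) (trans (cong (isSDT′ N) (sym split)) standard))
  T′-standard : isSDT′ m T′ ≡ true
  T′-standard = proj₁ (∧-true⁻ parts)
  domino : isDomino (padCells 0 (shrink λ' c) c) ≡ true
  domino = proj₁ (∧-true⁻ (proj₂ (∧-true⁻ {isSDT′ m T′} parts)))
  below : nothingBelowPads (shrink λ' c) c ≡ true
  below = proj₂ (∧-true⁻ (proj₂ (∧-true⁻ {isSDT′ m T′} parts)))
  c-removable : removable λ' c ≡ true
  c-removable = cong₂ _∧_ domino (cong₂ _∧_ (fits-countLabels N T) below)
  c-length : length c ≡ length λ'
  c-length = trans (length-map (countLabel N) T) (sym (length-map length T))
  c∈profiles : c ∈ dominoProfiles (length λ')
  c∈profiles = ∈-dominoProfiles (length λ') c-length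
    (trans (sym (length-padCells 0 (shrink λ' c) c (trans (length-shrink λ' c) (sym c-length))))
           (isDomino⇒length≡2 (padCells 0 (shrink λ' c) c) domino))
  T∈block : T ∈ withTopDomino λ' m c
  T∈block rewrite c-removable =
    subst (_∈ map (λ T → pad N T c) (standardFillings (shrink λ' c) m)) (sym split)
      (∈-map⁺ (λ T → pad N T c)
        (∈-standardFillings⁺ (shrink λ' c) m (∈-fillings⁺ (shrink λ' c) m T′-shape T′-labels) T′-standard))

-- Sorting standard fillings by the position of their largest domino.
count-suc : ∀ λ' m →
  count λ' (suc m) ≡ sum (map (λ c → when (removable λ' c) (count (shrink λ' c) m)) (dominoProfiles (length λ')))
count-suc λ' m = begin
  count λ' (suc m)
    ≡⟨ length-unique-cong (Unique.filter⁺ _ (fillings-unique λ' (suc m))) byTop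
                          (standard⊆withTopDomino λ' m) withTop⊆standard ⟩
  length (concatMap (withTopDomino λ' m) profiles)
    ≡⟨ length-concatMap (withTopDomino λ' m) profiles ⟩
  sum (map (length ∘ withTopDomino λ' m) profiles)
    ≡⟨ cong sum (map-cong (λ c → length-padAll λ' m c (removable λ' c)) profiles) ⟩
  sum (map (λ c → when (removable λ' c) (count (shrink λ' c) m)) profiles) ∎
  where
  open ≡-Reasoning
  profiles = dominoProfiles (length λ')
  byTop : Unique (concatMap (withTopDomino λ' m) profiles)
  byTop = concatMap-unique (map (countLabel (suc m))) (withTopDomino λ' m)
            (dominoProfiles-unique (length λ'))
            (λ c → padAll-unique λ' m c (removable λ' c))
            (λ {c} c∈ → countLabels-padAll λ' m c (removable λ' c) (proj₁ (∈-words⁻ _ (length λ') c∈)))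
  withTop⊆standard : ∀ {T} → T ∈ concatMap (withTopDomino λ' m) profiles → T ∈ standardFillings λ' (suc m)
  withTop⊆standard T∈ with find (∈-concatMap⁻ (withTopDomino λ' m) {xs = profiles} T∈)
  ... | c , _ , T∈block = padAll⊆standard λ' m c (removable λ' c) refl T∈block

-- Binomial coefficients and sums

half : ℕ → ℕ
half zero          = 0
half (suc zero)    = 0
half (suc (suc n)) = suc (half n)

half≡/2 : ∀ n → half n ≡ n / 2
half≡/2 zero          = refl
half≡/2 (suc zero)    = refl
half≡/2 (suc (suc n)) = trans (cong suc (half≡/2 n)) (sym (m/n≡1+[m∸n]/n {suc (suc n)} {2} (s≤s (s≤s z≤n))))

half+half-suc : ∀ n → half n + half (suc n) ≡ n
half+half-suc zero          = refl
half+half-suc (suc zero)    = refl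
half+half-suc (suc (suc n)) = cong suc (trans (+-suc (half n) (half (suc n))) (cong suc (half+half-suc n)))

double : ℕ → ℕ
double zero    = 0
double (suc n) = suc (suc (double n))

double≡+ : ∀ n → double n ≡ n + n
double≡+ zero    = refl
double≡+ (suc n) = cong suc (trans (cong suc (double≡+ n)) (sym (+-suc n n)))

half-double : ∀ n → half (double n) ≡ n
half-double zero    = refl
half-double (suc n) = cong suc (half-double n)

double/2 : ∀ n → double n / 2 ≡ n
double/2 n = trans (sym (half≡/2 (double n))) (half-double n)

double-half≤ : ∀ n → double (half n) ≤ n
double-half≤ zero          = z≤n
double-half≤ (suc zero)    = z≤n
double-half≤ (suc (suc n)) = s≤s (s≤s (double-half≤ n))

double-mono-≤ : ∀ {m n} → m ≤ n → double m ≤ double n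
double-mono-≤ z≤n       = z≤n
double-mono-≤ (s≤s m≤n) = s≤s (s≤s (double-mono-≤ m≤n))

+-double-injective : ∀ {x y} → x + x ≡ y + y → x ≡ y
+-double-injective {x} {y} eq =
  trans (sym (half-double x)) (trans (cong half (trans (double≡+ x) (trans eq (sym (double≡+ y))))) (half-double y))

binom : ℕ → ℕ → ℕ
binom n       zero    = 1
binom zero    (suc k) = 0
binom (suc n) (suc k) = binom n k + binom n (suc k)

binom≡C : ∀ n k → binom n k ≡ n C k
binom≡C n       zero    = refl
binom≡C zero    (suc k) = refl
binom≡C (suc n) (suc k) = trans (cong₂ _+_ (binom≡C n k) (binom≡C n (suc k))) (nCk+nC[k+1]≡[n+1]C[k+1] n k)

binom-above : ∀ {n k} → n < k → binom n k ≡ 0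
binom-above {n} {k} n<k = trans (binom≡C n k) (k>n⇒nCk≡0 n<k)

binom-reflect : ∀ {m j} → j ≤ m → binom m (m ∸ j) ≡ binom m j
binom-reflect {m} {j} j≤m =
  trans (binom≡C m (m ∸ j)) (trans (sym (nCk≡nC[n∸k] j≤m)) (sym (binom≡C m j)))

binom-sym : ∀ i j → binom (i + j) i ≡ binom (i + j) j
binom-sym i j = trans (cong (binom (i + j)) (sym (m+n∸n≡m i j))) (binom-reflect (m≤n+m j i))

binom-middle : ∀ n → binom (suc n) (half (suc n)) ≡ binom (suc n) (suc (half n))
binom-middle n = trans (sym (binom-reflect (≤-trans (m≤m+n (half (suc n)) (suc (half n))) (≤-reflexive ceil))))
                       (cong (binom (suc n)) (trans (cong (_∸ half (suc n)) (sym ceil)) (m+n∸m≡n (half (suc n)) _)))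
  where
  ceil : half (suc n) + suc (half n) ≡ suc n
  ceil = trans (+-suc _ _) (cong suc (trans (+-comm (half (suc n)) (half n)) (half+half-suc n)))

binom-absorb : ∀ n k → suc k * binom (suc n) (suc k) ≡ suc n * binom n k
binom-absorb zero    zero    = refl
binom-absorb zero    (suc k) = *-zeroʳ (suc (suc k))
binom-absorb (suc n) zero    = begin
  1 * binom (suc (suc n)) 1       ≡⟨ *-identityˡ _ ⟩
  suc (binom (suc n) 1)           ≡⟨ cong suc (trans (sym (*-identityˡ _)) (binom-absorb n zero)) ⟩
  suc (suc n * 1)                 ∎
  where open ≡-Reasoning
binom-absorb (suc n) (suc k) = begin
  suc (suc k) * (binom (suc n) (suc k) + binom (suc n) (suc (suc k)))
    ≡⟨ spread k (binom (suc n) (suc k)) (binom (suc n) (suc (suc k))) ⟩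
  binom (suc n) (suc k) + (suc k * binom (suc n) (suc k) + suc (suc k) * binom (suc n) (suc (suc k)))
    ≡⟨ cong (binom (suc n) (suc k) +_) (cong₂ _+_ (binom-absorb n k) (binom-absorb n (suc k))) ⟩
  binom (suc n) (suc k) + (suc n * binom n k + suc n * binom n (suc k))
    ≡⟨ gather n (binom n k) (binom n (suc k)) ⟩
  suc (suc n) * (binom n k + binom n (suc k)) ∎
  where
  open ≡-Reasoning
  spread : ∀ k x y → suc (suc k) * (x + y) ≡ x + (suc k * x + suc (suc k) * y)
  spread = solve-∀
  gather : ∀ n x y → (x + y) + (suc n * x + suc n * y) ≡ suc (suc n) * (x + y)
  gather = solve-∀

catalan : ∀ m → binom (m + m) m * suc (suc m) ≡ binom (suc m + suc m) (suc m) + binom (m + m) (suc (suc m)) * suc (suc m)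
catalan m = subst (λ K₂ → a * suc (suc m) ≡ binom K₂ (suc m) + c * suc (suc m)) (sym K₂≡)
                  (+-cancelˡ-≡ (suc m * P) _ _ (begin
  suc m * P + a * suc (suc m)        ≡⟨ cong (_+ a * suc (suc m)) (sym absorbed) ⟩
  suc (suc m) * Q + a * suc (suc m)  ≡⟨ regroup₁ a Q m ⟩
  (a + Q) * suc (suc m)              ≡⟨ cong (_* suc (suc m)) pascal ⟩
  (P + c) * suc (suc m)              ≡⟨ regroup₂ P c m ⟩
  suc m * P + (P + c * suc (suc m))  ∎))
  where
  open ≡-Reasoning
  K = m + m
  a = binom K m
  c = binom K (suc (suc m))
  d = binom K (suc m)
  P = binom (suc (suc K)) (suc m)
  Q = binom (suc (suc K)) (suc (suc m))
  K₂≡ : suc m + suc m ≡ suc (suc K)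
  K₂≡ = cong suc (+-suc m m)
  symmetric : binom (suc K) m ≡ binom (suc K) (suc m)
  symmetric = subst (λ n → binom n m ≡ binom n (suc m)) (+-suc m m) (binom-sym m (suc m))
  pascal : a + Q ≡ P + c
  pascal = trans (regroup a d c) (cong (λ x → x + (a + d) + c) (sym symmetric))
    where regroup : ∀ a d c → a + ((a + d) + (d + c)) ≡ (a + d) + (a + d) + c
          regroup = solve-∀
  absorbed : suc (suc m) * Q ≡ suc m * P
  absorbed = trans (binom-absorb (suc K) (suc m))
                   (trans (cong (suc (suc K) *_) (sym symmetric)) (sym (binom-absorb (suc K) m)))
  regroup₁ : ∀ a q m → suc (suc m) * q + a * suc (suc m) ≡ (a + q) * suc (suc m)
  regroup₁ = solve-∀
  regroup₂ : ∀ p c m → (p + c) * suc (suc m) ≡ suc m * p + (p + c * suc (suc m))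
  regroup₂ = solve-∀

-- binom₋₂ m i = binom m (i − 2), read as 0 for i < 2.
binom₋₂ : ℕ → ℕ → ℕ
binom₋₂ m zero          = 0
binom₋₂ m (suc zero)    = 0
binom₋₂ m (suc (suc i)) = binom m i

binom₋₂-pascal : ∀ m i → binom₋₂ (suc m) (suc i) ≡ binom₋₂ m i + binom₋₂ m (suc i)
binom₋₂-pascal m zero          = refl
binom₋₂-pascal m (suc zero)    = refl
binom₋₂-pascal m (suc (suc i)) = refl

binom₋₂-reflect : ∀ m i → i ≤ suc (suc m) → binom₋₂ m i ≡ binom m (suc (suc m) ∸ i)
binom₋₂-reflect m zero          _       = sym (binom-above (m≤n⇒m≤1+n (n<1+n m)))
binom₋₂-reflect m (suc zero)    _       = sym (binom-above (n<1+n m))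
binom₋₂-reflect m (suc (suc i)) (s≤s (s≤s i≤m)) = sym (binom-reflect i≤m)

∑ : ℕ → (ℕ → ℕ) → ℕ
∑ zero    f = 0
∑ (suc n) f = f 0 + ∑ n (f ∘ suc)

syntax ∑ n (λ i → e) = ∑[ i < n ] e

∑-applyUpTo : ∀ n (f g : ℕ → ℕ) → sum (map f (applyUpTo g n)) ≡ ∑[ i < n ] f (g i)
∑-applyUpTo zero    f g = refl
∑-applyUpTo (suc n) f g = cong (f (g 0) +_) (∑-applyUpTo n f (g ∘ suc))

∑-upTo : ∀ n f → sum (map f (upTo n)) ≡ ∑ n f
∑-upTo n f = ∑-applyUpTo n f id

∑-cong : ∀ n {f g} → (∀ i → i < n → f i ≡ g i) → ∑ n f ≡ ∑ n g
∑-cong zero    f≗g = refl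
∑-cong (suc n) f≗g = cong₂ _+_ (f≗g 0 (s≤s z≤n)) (∑-cong n λ i i<n → f≗g (suc i) (s≤s i<n))

∑-last : ∀ n f → ∑ (suc n) f ≡ ∑ n f + f n
∑-last zero    f = +-comm (f 0) 0
∑-last (suc n) f = trans (cong (f 0 +_) (∑-last n (f ∘ suc))) (sym (+-assoc (f 0) _ _))

∑-+ : ∀ n f g → ∑[ i < n ] (f i + g i) ≡ ∑ n f + ∑ n g
∑-+ zero    f g = refl
∑-+ (suc n) f g = trans (cong (f 0 + g 0 +_) (∑-+ n (f ∘ suc) (g ∘ suc))) (interchange (f 0) (g 0) _ _)
  where interchange : ∀ w x y z → w + x + (y + z) ≡ w + y + (x + z)
        interchange = solve-∀

∑-vanishing : ∀ n f → (∀ i → i < n → f i ≡ 0) → ∑ n f ≡ 0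
∑-vanishing zero    f f≡0 = refl
∑-vanishing (suc n) f f≡0 =
  cong₂ _+_ (f≡0 0 (s≤s z≤n)) (∑-vanishing n (f ∘ suc) λ i i<n → f≡0 (suc i) (s≤s i<n))

∑-half : ∀ n f → (∀ i → i ≤ n → f (n ∸ i) ≡ f i) → ∑[ k < suc n ] f (half k) ≡ ∑ (suc n) f
∑-half zero          f palindrome = refl
∑-half (suc zero)    f palindrome = cong (λ x → f 0 + (x + 0)) (sym (palindrome 0 z≤n))
∑-half (suc (suc n)) f palindrome = begin
  f 0 + (f 0 + ∑[ k < suc n ] f (suc (half k)))
    ≡⟨ cong (λ x → f 0 + (x + ∑[ k < suc n ] f (suc (half k)))) (sym (palindrome 0 z≤n)) ⟩
  f 0 + (f (suc (suc n)) + ∑[ k < suc n ] f (suc (half k)))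
    ≡⟨ cong (λ x → f 0 + (f (suc (suc n)) + x)) (∑-half n (f ∘ suc) palindrome′) ⟩
  f 0 + (f (suc (suc n)) + ∑ (suc n) (f ∘ suc))
    ≡⟨ cong (f 0 +_) (trans (+-comm (f (suc (suc n))) _) (sym (∑-last (suc n) (f ∘ suc)))) ⟩
  f 0 + ∑ (suc (suc n)) (f ∘ suc) ∎
  where
  open ≡-Reasoning
  palindrome′ : ∀ i → i ≤ n → f (suc (n ∸ i)) ≡ f (suc i)
  palindrome′ i i≤n = trans (cong f (sym (+-∸-assoc 1 i≤n))) (palindrome (suc i) (s≤s (m≤n⇒m≤1+n i≤n)))

∑-fold : ∀ N f → (∀ i → i ≤ N → f (N ∸ i) ≡ f i) → (∀ i → i + i ≡ N → f i ≡ 0) →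
  ∑ (suc N) f ≡ ∑[ i < half (suc N) ] (f i + f i)
∑-fold zero          f palindrome middle = cong (_+ 0) (middle 0 refl)
∑-fold (suc zero)    f palindrome middle =
  trans (cong (λ x → f 0 + (x + 0)) (palindrome 0 z≤n)) (sym (+-assoc (f 0) (f 0) 0))
∑-fold (suc (suc N)) f palindrome middle = begin
  f 0 + ∑ (suc (suc N)) (f ∘ suc)
    ≡⟨ cong (f 0 +_) (∑-last (suc N) (f ∘ suc)) ⟩
  f 0 + (∑ (suc N) (f ∘ suc) + f (suc (suc N)))
    ≡⟨ cong (λ x → f 0 + (∑ (suc N) (f ∘ suc) + x)) (palindrome 0 z≤n) ⟩
  f 0 + (∑ (suc N) (f ∘ suc) + f 0)
    ≡⟨ cong (λ x → f 0 + (x + f 0)) (∑-fold N (f ∘ suc) palindrome′ middle′) ⟩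
  f 0 + (∑[ i < half (suc N) ] (f (suc i) + f (suc i)) + f 0)
    ≡⟨ regroup (f 0) _ ⟩
  f 0 + f 0 + ∑[ i < half (suc N) ] (f (suc i) + f (suc i)) ∎
  where
  open ≡-Reasoning
  palindrome′ : ∀ i → i ≤ N → f (suc (N ∸ i)) ≡ f (suc i)
  palindrome′ i i≤N = trans (cong f (sym (+-∸-assoc 1 i≤N))) (palindrome (suc i) (s≤s (m≤n⇒m≤1+n i≤N)))
  middle′ : ∀ i → i + i ≡ N → f (suc i) ≡ 0
  middle′ i i+i≡N = middle (suc i) (cong suc (trans (+-suc i i) (cong suc i+i≡N)))
  regroup : ∀ x y → x + (y + x) ≡ x + x + y
  regroup = solve-∀

vandermonde : ∀ a b c → ∑[ j < suc c ] (binom a j * binom b (c ∸ j)) ≡ binom (a + b) c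
vandermonde zero    b c       =
  trans (cong₂ _+_ (+-identityʳ (binom b c)) (∑-vanishing c _ λ _ _ → refl)) (+-identityʳ _)
vandermonde (suc a) b zero    = refl
vandermonde (suc a) b (suc c) = begin
  1 * binom b (suc c) + ∑[ j < suc c ] ((binom a j + binom a (suc j)) * binom b (c ∸ j))
    ≡⟨ cong (1 * binom b (suc c) +_)
            (trans (∑-cong (suc c) λ j _ → *-distribʳ-+ (binom b (c ∸ j)) (binom a j) (binom a (suc j)))
                   (∑-+ (suc c) F G)) ⟩
  1 * binom b (suc c) + (∑ (suc c) F + ∑ (suc c) G)
    ≡⟨ cong (λ x → 1 * binom b (suc c) + (x + ∑ (suc c) G)) (vandermonde a b c) ⟩
  1 * binom b (suc c) + (binom (a + b) c + ∑ (suc c) G)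
    ≡⟨ regroup (binom b (suc c)) (binom (a + b) c) _ ⟩
  binom (a + b) c + (1 * binom b (suc c) + ∑ (suc c) G)
    ≡⟨ cong (binom (a + b) c +_) (vandermonde a b (suc c)) ⟩
  binom (a + b) c + binom (a + b) (suc c) ∎
  where
  open ≡-Reasoning
  F G : ℕ → ℕ
  F j = binom a j * binom b (c ∸ j)
  G j = binom a (suc j) * binom b (c ∸ j)
  regroup : ∀ x y z → 1 * x + (y + z) ≡ y + (1 * x + z)
  regroup = solve-∀

∑-binom² : ∀ n → ∑[ j < suc n ] (binom n j * binom n j) ≡ binom (n + n) n
∑-binom² n = trans (∑-cong (suc n) λ j j≤n → cong (binom n j *_) (sym (binom-reflect (≤-pred j≤n))))
                   (vandermonde n n n)

-- Two-row shapes

removable-02 : ∀ a b → removable (a ∷ b ∷ []) (0 ∷ 2 ∷ []) ≡ (2 ≤ᵇ b)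
removable-02 a zero          = refl
removable-02 a (suc zero)    = refl
removable-02 a (suc (suc b)) rewrite ≡ᵇ-refl b = refl

removable-11 : ∀ a b → removable (a ∷ b ∷ []) (1 ∷ 1 ∷ []) ≡ (1 ≤ᵇ b) ∧ (a ≡ᵇ b)
removable-11 zero    zero    = refl
removable-11 zero    (suc b) = ∧-zeroʳ _
removable-11 (suc a) zero    = ∧-zeroʳ _
removable-11 (suc a) (suc b) with a ≡ᵇ b in a≡ᵇb
... | false = refl
... | true rewrite ≡ᵇ-true⇒≡ {a} a≡ᵇb | ≤⇒≤ᵇ-true (≤-refl {b}) = refl

removable-20 : ∀ a b → removable (a ∷ b ∷ []) (2 ∷ 0 ∷ []) ≡ (2 + b ≤ᵇ a)
removable-20 zero          b = refl
removable-20 (suc zero)    b = refl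
removable-20 (suc (suc a)) b rewrite ≡ᵇ-refl a =
  trans (∧-identityʳ (b ≤ᵇ a)) (sym (trans (suc≤ᵇsuc (suc b) (suc a)) (suc≤ᵇsuc b a)))

count-2rows-suc : ∀ a b m → count (a ∷ b ∷ []) (suc m)
  ≡ when (2 ≤ᵇ b) (count (a ∷ b ∸ 2 ∷ []) m)
  + when ((1 ≤ᵇ b) ∧ (a ≡ᵇ b)) (count (a ∸ 1 ∷ b ∸ 1 ∷ []) m)
  + when (2 + b ≤ᵇ a) (count (a ∸ 2 ∷ b ∷ []) m)
count-2rows-suc a b m = begin
  count (a ∷ b ∷ []) (suc m)
    ≡⟨ count-suc (a ∷ b ∷ []) m ⟩
  when (removable (a ∷ b ∷ []) (0 ∷ 2 ∷ [])) x + (when (removable (a ∷ b ∷ []) (1 ∷ 1 ∷ [])) y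
    + (when (removable (a ∷ b ∷ []) (2 ∷ 0 ∷ [])) z + 0))
    ≡⟨ cong₂ _+_ (cong (λ g → when g x) (removable-02 a b))
                 (cong₂ _+_ (cong (λ g → when g y) (removable-11 a b))
                            (trans (+-identityʳ _) (cong (λ g → when g z) (removable-20 a b)))) ⟩
  when (2 ≤ᵇ b) x + (when ((1 ≤ᵇ b) ∧ (a ≡ᵇ b)) y + when (2 + b ≤ᵇ a) z)
    ≡⟨ sym (+-assoc (when (2 ≤ᵇ b) x) _ _) ⟩
  when (2 ≤ᵇ b) x + when ((1 ≤ᵇ b) ∧ (a ≡ᵇ b)) y + when (2 + b ≤ᵇ a) z ∎
  where
  open ≡-Reasoning
  x = count (a ∷ b ∸ 2 ∷ []) m
  y = count (a ∸ 1 ∷ b ∸ 1 ∷ []) m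
  z = count (a ∸ 2 ∷ b ∷ []) m

count-2rows : ∀ b e {a m} → a ≡ b + double e → m ≡ b + e → count (a ∷ b ∷ []) m ≡ binom m (half b)
count-2rows zero          zero    refl refl = refl
count-2rows zero          (suc e) refl refl =
  trans (count-2rows-suc (suc (suc (double e))) 0 e) (count-2rows zero e refl refl)
count-2rows (suc zero)    zero    refl refl = refl
count-2rows (suc zero)    (suc e) refl refl =
  trans (count-2rows-suc (suc (suc (suc (double e)))) 1 (suc e)) (count-2rows 1 e refl refl)
count-2rows (suc (suc b)) zero    refl refl = begin
  count (suc (suc b + 0) ∷ suc (suc b) ∷ []) (suc (suc b + 0))
    ≡⟨ cong (λ a → count (suc (suc a) ∷ suc (suc b) ∷ []) (suc (suc a))) (+-identityʳ b) ⟩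
  count (suc (suc b) ∷ suc (suc b) ∷ []) (suc (suc b))
    ≡⟨ count-2rows-suc (suc (suc b)) (suc (suc b)) (suc b) ⟩
  x + when (b ≡ᵇ b) y + when (4 + b ≤ᵇ suc (suc b)) (count (b ∷ suc (suc b) ∷ []) (suc b))
    ≡⟨ cong₂ (λ g g′ → x + when g y + when g′ (count (b ∷ suc (suc b) ∷ []) (suc b)))
             (≡ᵇ-refl b)
             (≰⇒≤ᵇ-false {4 + b} λ 4+b≤2+b → 1+n≰n (≤-trans (n≤1+n _) (≤-pred (≤-pred 4+b≤2+b)))) ⟩
  x + y + 0
    ≡⟨ +-identityʳ _ ⟩
  x + y
    ≡⟨ cong₂ _+_ (count-2rows b 1 (+-comm 2 b) (+-comm 1 b))
                 (count-2rows (suc b) 0 (sym (+-identityʳ _)) (sym (+-identityʳ _))) ⟩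
  binom (suc b) (half b) + binom (suc b) (half (suc b))
    ≡⟨ cong (binom (suc b) (half b) +_) (binom-middle b) ⟩
  binom (suc (suc b)) (suc (half b))
    ≡⟨ cong (λ m → binom (suc (suc m)) (suc (half b))) (sym (+-identityʳ b)) ⟩
  binom (suc (suc b + 0)) (suc (half b)) ∎
  where
  open ≡-Reasoning
  x = count (suc (suc b) ∷ b ∷ []) (suc b)
  y = count (suc b ∷ suc b ∷ []) (suc b)
count-2rows (suc (suc b)) (suc e) refl refl = begin
  count (suc (suc (b + suc (suc D))) ∷ suc (suc b) ∷ []) (suc (suc (b + suc e)))
    ≡⟨ cong₂ (λ a m → count (a ∷ suc (suc b) ∷ []) m) (shape b D) (size b e) ⟩
  count (a ∷ suc (suc b) ∷ []) (suc M)
    ≡⟨ count-2rows-suc a (suc (suc b)) M ⟩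
  x + when (suc (suc (b + D)) ≡ᵇ b) (count (suc (suc (suc (b + D))) ∷ suc b ∷ []) M) + when (4 + b ≤ᵇ a) z
    ≡⟨ cong₂ (λ g g′ → x + when g (count (suc (suc (suc (b + D))) ∷ suc b ∷ []) M) + when g′ z)
             (≢⇒≡ᵇ-false λ eq → m≢1+m+n b (sym (trans (cong suc (+-suc b D)) eq)))
             (≤⇒≤ᵇ-true (s≤s (s≤s (s≤s (s≤s (m≤m+n b D)))))) ⟩
  x + 0 + z
    ≡⟨ cong₂ _+_ (trans (+-identityʳ _) (count-2rows b (suc (suc e)) (shape′ b D) (size′ b e)))
                 (count-2rows (suc (suc b)) e refl refl) ⟩
  binom M (half b) + binom M (suc (half b))
    ≡⟨ cong (λ m → binom m (suc (half b))) (sym (size b e)) ⟩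
  binom (suc (suc (b + suc e))) (suc (half b)) ∎
  where
  open ≡-Reasoning
  D = double e
  a = suc (suc (suc (suc (b + D))))
  M = suc (suc (b + e))
  x = count (a ∷ b ∷ []) M
  z = count (suc (suc (b + D)) ∷ suc (suc b) ∷ []) M
  shape : ∀ b d → suc (suc (b + suc (suc d))) ≡ suc (suc (suc (suc (b + d))))
  shape = solve-∀
  size : ∀ b e → suc (suc (b + suc e)) ≡ suc (suc (suc (b + e)))
  size = solve-∀
  shape′ : ∀ b d → suc (suc (suc (suc (b + d)))) ≡ b + suc (suc (suc (suc d)))
  shape′ = solve-∀
  size′ : ∀ b e → suc (suc (b + e)) ≡ b + suc (suc e)
  size′ = solve-∀

f₂-2rows′ : ∀ k d → f₂ (2 * (k + d) ∸ k ∷ k ∷ []) ≡ binom (k + d) (half k)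
f₂-2rows′ k d = begin
  f₂ (a ∷ k ∷ []) ≡⟨ f₂≡count-2rows a k ⟩
  count (a ∷ k ∷ []) ((a + (k + 0)) / 2) ≡⟨ cong (λ m → count (a ∷ k ∷ []) m) size ⟩
  count (a ∷ k ∷ []) (k + d) ≡⟨ count-2rows k d a≡ refl ⟩
  binom (k + d) (half k) ∎
  where
  open ≡-Reasoning
  a = 2 * (k + d) ∸ k
  a≡ : a ≡ k + double d
  a≡ = trans (cong (_∸ k) (twice k d)) (m+n∸n≡m _ k)
    where twice : ∀ k d → 2 * (k + d) ≡ k + double d + k
          twice k d rewrite double≡+ d = arith k d
            where arith : ∀ k d → 2 * (k + d) ≡ k + (d + d) + k
                  arith = solve-∀
  cells : k + double d + (k + 0) ≡ double (k + d)
  cells rewrite double≡+ d | double≡+ (k + d) = arith k d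
    where arith : ∀ k d → k + (d + d) + (k + 0) ≡ k + d + (k + d)
          arith = solve-∀
  size : (a + (k + 0)) / 2 ≡ k + d
  size = trans (cong (λ x → (x + (k + 0)) / 2) a≡) (trans (cong (_/ 2) cells) (double/2 (k + d)))

f₂-2rows : ∀ {n k} → k ≤ n → f₂ (2 * n ∸ k ∷ k ∷ []) ≡ binom n (half k)
f₂-2rows {n} {k} k≤n with n ∸ k | m+[n∸m]≡n k≤n
... | d | refl = f₂-2rows′ k d

-- The shapes (a, b, 1)

removable-011 : ∀ a b → removable (a ∷ b ∷ 1 ∷ []) (0 ∷ 1 ∷ 1 ∷ []) ≡ (b ≡ᵇ 1)
removable-011 a zero          = refl
removable-011 a (suc zero)    = refl
removable-011 a (suc (suc b)) = refl

removable-020 : ∀ a b → removable (a ∷ b ∷ 1 ∷ []) (0 ∷ 2 ∷ 0 ∷ []) ≡ (3 ≤ᵇ b)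
removable-020 a zero          = refl
removable-020 a (suc zero)    = refl
removable-020 a (suc (suc b)) rewrite ≡ᵇ-refl b = ∧-identityʳ _

removable-101 : ∀ a b → removable (a ∷ b ∷ 1 ∷ []) (1 ∷ 0 ∷ 1 ∷ []) ≡ false
removable-101 a b rewrite ∧-zeroʳ (a ∸ 1 ≡ᵇ 0) = refl

removable-110 : ∀ {a b} → a ≢ b → removable (a ∷ b ∷ 1 ∷ []) (1 ∷ 1 ∷ 0 ∷ []) ≡ false
removable-110 {zero}  {b}     _   = ∧-zeroʳ _
removable-110 {suc a} {zero}  _   = ∧-zeroʳ _
removable-110 {suc a} {suc b} a≢b rewrite ≢⇒≡ᵇ-false (a≢b ∘ cong suc) = refl

removable-200 : ∀ a b c → removable (a ∷ b ∷ c ∷ []) (2 ∷ 0 ∷ 0 ∷ []) ≡ (2 + b ≤ᵇ a)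
removable-200 zero          b c = refl
removable-200 (suc zero)    b c = refl
removable-200 (suc (suc a)) b c rewrite ≡ᵇ-refl a =
  trans (∧-identityʳ (b ≤ᵇ a)) (sym (trans (suc≤ᵇsuc (suc b) (suc a)) (suc≤ᵇsuc b a)))

count-3rows-suc : ∀ a b m → a ≢ b → count (a ∷ b ∷ 1 ∷ []) (suc m)
  ≡ when (b ≡ᵇ 1) (count (a ∷ b ∸ 1 ∷ 0 ∷ []) m)
  + when (3 ≤ᵇ b) (count (a ∷ b ∸ 2 ∷ 1 ∷ []) m)
  + when (2 + b ≤ᵇ a) (count (a ∸ 2 ∷ b ∷ 1 ∷ []) m)
count-3rows-suc a b m a≢b = begin
  count (a ∷ b ∷ 1 ∷ []) (suc m)
    ≡⟨ count-suc (a ∷ b ∷ 1 ∷ []) m ⟩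
  when (removable λ' (0 ∷ 1 ∷ 1 ∷ [])) x + (when (removable λ' (0 ∷ 2 ∷ 0 ∷ [])) y
    + (when (removable λ' (1 ∷ 0 ∷ 1 ∷ [])) (count (a ∸ 1 ∷ b ∷ 0 ∷ []) m)
    + (when (removable λ' (1 ∷ 1 ∷ 0 ∷ [])) (count (a ∸ 1 ∷ b ∸ 1 ∷ 1 ∷ []) m)
    + (when (removable λ' (2 ∷ 0 ∷ 0 ∷ [])) z + 0))))
    ≡⟨ cong₂ _+_ (cong (λ g → when g x) (removable-011 a b))
         (cong₂ _+_ (cong (λ g → when g y) (removable-020 a b))
           (cong₂ _+_ (cong (λ g → when g (count (a ∸ 1 ∷ b ∷ 0 ∷ []) m)) (removable-101 a b))
             (cong₂ _+_ (cong (λ g → when g (count (a ∸ 1 ∷ b ∸ 1 ∷ 1 ∷ []) m)) (removable-110 a≢b))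
               (trans (+-identityʳ _) (cong (λ g → when g z) (removable-200 a b 1)))))) ⟩
  when (b ≡ᵇ 1) x + (when (3 ≤ᵇ b) y + when (2 + b ≤ᵇ a) z)
    ≡⟨ sym (+-assoc (when (b ≡ᵇ 1) x) _ _) ⟩
  when (b ≡ᵇ 1) x + when (3 ≤ᵇ b) y + when (2 + b ≤ᵇ a) z ∎
  where
  open ≡-Reasoning
  λ' = a ∷ b ∷ 1 ∷ []
  x = count (a ∷ b ∸ 1 ∷ 0 ∷ []) m
  y = count (a ∷ b ∸ 2 ∷ 1 ∷ []) m
  z = count (a ∸ 2 ∷ b ∷ 1 ∷ []) m

count-1row : ∀ t → count (double t ∷ 0 ∷ 0 ∷ []) t ≡ 1
count-1row zero    = refl
count-1row (suc t) = begin
  count (suc (suc (double t)) ∷ 0 ∷ 0 ∷ []) (suc t)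
    ≡⟨ count-suc (suc (suc (double t)) ∷ 0 ∷ 0 ∷ []) t ⟩
  when (removable (suc (suc (double t)) ∷ 0 ∷ 0 ∷ []) (2 ∷ 0 ∷ 0 ∷ [])) (count (double t ∷ 0 ∷ 0 ∷ []) t) + 0
    ≡⟨ +-identityʳ _ ⟩
  when (removable (suc (suc (double t)) ∷ 0 ∷ 0 ∷ []) (2 ∷ 0 ∷ 0 ∷ [])) (count (double t ∷ 0 ∷ 0 ∷ []) t)
    ≡⟨ cong (λ g → when g (count (double t ∷ 0 ∷ 0 ∷ []) t)) (removable-200 (suc (suc (double t))) 0 0) ⟩
  count (double t ∷ 0 ∷ 0 ∷ []) t
    ≡⟨ count-1row t ⟩
  1 ∎
  where open ≡-Reasoning

count-3rows : ∀ k e {a b M} →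
  a ≡ suc (suc (double k + double e)) → b ≡ suc (double k) → M ≡ suc (double k + e) →
  count (a ∷ b ∷ 1 ∷ []) (suc M) + binom₋₂ M (suc k) ≡ binom M (suc k)
count-3rows zero    zero    refl refl refl = refl
count-3rows zero    (suc e) refl refl refl = begin
  count (a ∷ 1 ∷ 1 ∷ []) (suc (suc (suc e))) + 0
    ≡⟨ cong (_+ 0) (count-3rows-suc a 1 (suc (suc e)) (λ ())) ⟩
  count (a ∷ 0 ∷ 0 ∷ []) (suc (suc e)) + 0 + count (a ∸ 2 ∷ 1 ∷ 1 ∷ []) (suc (suc e)) + 0
    ≡⟨ cong (λ x → x + 0 + count (a ∸ 2 ∷ 1 ∷ 1 ∷ []) (suc (suc e)) + 0) (count-1row (suc (suc e))) ⟩
  suc (count (a ∸ 2 ∷ 1 ∷ 1 ∷ []) (suc (suc e)) + 0)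
    ≡⟨ cong suc (count-3rows zero e refl refl refl) ⟩
  binom (suc (suc e)) 1 ∎
  where
  open ≡-Reasoning
  a = suc (suc (suc (suc (double e))))
count-3rows (suc k) zero    refl refl refl = begin
  count (a ∷ b ∷ 1 ∷ []) (suc (suc P)) + binom₋₂ (suc P) (suc (suc k))
    ≡⟨ cong (_+ binom₋₂ (suc P) (suc (suc k)))
            (count-3rows-suc a b (suc P) λ eq → m≢1+m+n D (sym (suc-injective (suc-injective (suc-injective eq))))) ⟩
  0 + y + when (5 + D ≤ᵇ a) z + binom₋₂ (suc P) (suc (suc k))
    ≡⟨ cong₂ (λ g u → y + when g z + u)
             (≰⇒≤ᵇ-false {5 + D} λ 5+D≤4+D → 1+n≰n (≤-trans (≤-pred (≤-pred (≤-pred (≤-pred 5+D≤4+D))))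
                                                           (≤-reflexive (+-identityʳ D))))
             (binom₋₂-pascal P (suc k)) ⟩
  y + 0 + (binom₋₂ P (suc k) + binom P k)
    ≡⟨ regroup y (binom₋₂ P (suc k)) (binom P k) ⟩
  (y + binom₋₂ P (suc k)) + binom P k
    ≡⟨ cong₂ _+_ (count-3rows k 1 (shape D) refl (size D)) binom-sym′ ⟩
  binom P (suc k) + binom P (suc (suc k)) ∎
  where
  open ≡-Reasoning
  D = double k
  a = suc (suc (suc (suc (D + 0))))
  b = suc (suc (suc D))
  P = suc (suc (D + 0))
  y = count (a ∷ suc D ∷ 1 ∷ []) (suc P)
  z = count (suc (suc (D + 0)) ∷ b ∷ 1 ∷ []) (suc P)
  regroup : ∀ x y z → x + 0 + (y + z) ≡ x + y + z
  regroup = solve-∀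
  shape : ∀ x → suc (suc (suc (suc (x + 0)))) ≡ suc (suc (x + 2))
  shape = solve-∀
  size : ∀ x → suc (suc (x + 0)) ≡ suc (x + 1)
  size = solve-∀
  P≡ : P ≡ k + suc (suc k)
  P≡ = trans (cong (suc ∘ suc) (trans (+-identityʳ D) (double≡+ k))) (arith k)
    where arith : ∀ x → suc (suc (x + x)) ≡ x + suc (suc x)
          arith = solve-∀
  binom-sym′ : binom P k ≡ binom P (suc (suc k))
  binom-sym′ = trans (cong (λ m → binom m k) P≡)
                     (trans (binom-sym k (suc (suc k))) (cong (λ m → binom m (suc (suc k))) (sym P≡)))
count-3rows (suc k) (suc e) refl refl refl = begin
  count (a ∷ b ∷ 1 ∷ []) (suc (suc P)) + binom₋₂ (suc P) (suc (suc k))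
    ≡⟨ cong (_+ binom₋₂ (suc P) (suc (suc k))) (count-3rows-suc a b (suc P) (a≢b D (double e))) ⟩
  0 + y + when (5 + D ≤ᵇ a) z + binom₋₂ (suc P) (suc (suc k))
    ≡⟨ cong₂ (λ g u → y + when g z + u)
             (≤⇒≤ᵇ-true {5 + D} {a} (s≤s (s≤s (s≤s (s≤s (m<m+n D (s≤s z≤n)))))))
             (binom₋₂-pascal P (suc k)) ⟩
  y + z + (binom₋₂ P (suc k) + binom₋₂ P (suc (suc k)))
    ≡⟨ interchange y z (binom₋₂ P (suc k)) (binom₋₂ P (suc (suc k))) ⟩
  (y + binom₋₂ P (suc k)) + (z + binom₋₂ P (suc (suc k)))
    ≡⟨ cong₂ _+_ (count-3rows k (suc (suc e)) (shapeY D (double e)) refl (sizeY D e))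
                 (count-3rows (suc k) e (shapeZ D (double e)) refl (sizeZ D e)) ⟩
  binom P (suc k) + binom P (suc (suc k)) ∎
  where
  open ≡-Reasoning
  D = double k
  a = suc (suc (suc (suc (D + suc (suc (double e))))))
  b = suc (suc (suc D))
  P = suc (suc (D + suc e))
  y = count (a ∷ suc D ∷ 1 ∷ []) (suc P)
  z = count (suc (suc (D + suc (suc (double e)))) ∷ b ∷ 1 ∷ []) (suc P)
  a≢b : ∀ x w → suc (suc (suc (suc (x + suc (suc w))))) ≢ suc (suc (suc x))
  a≢b x w eq = m≢1+m+n x (sym (suc-injective (suc-injective (suc-injective eq))))
  interchange : ∀ w x y z → w + x + (y + z) ≡ (w + y) + (x + z)
  interchange = solve-∀
  shapeY : ∀ x w → suc (suc (suc (suc (x + suc (suc w))))) ≡ suc (suc (x + suc (suc (suc (suc w)))))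
  shapeY = solve-∀
  sizeY : ∀ x e → suc (suc (x + suc e)) ≡ suc (x + suc (suc e))
  sizeY = solve-∀
  shapeZ : ∀ x w → suc (suc (x + suc (suc w))) ≡ suc (suc (suc (suc (x + w))))
  shapeZ = solve-∀
  sizeZ : ∀ x e → suc (suc (x + suc e)) ≡ suc (suc (suc (x + e)))
  sizeZ = solve-∀

f₂-3rows′ : ∀ k e → let M = suc (double k + e) in
  f₂ (2 * suc M ∸ 2 * suc k ∷ 2 * suc k ∸ 1 ∷ 1 ∷ []) + binom₋₂ M (suc k) ≡ binom M (suc k)
f₂-3rows′ k e = begin
  f₂ (a ∷ b ∷ 1 ∷ []) + binom₋₂ M (suc k)
    ≡⟨ cong (_+ binom₋₂ M (suc k)) (f₂≡count-3rows a b 1) ⟩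
  count (a ∷ b ∷ 1 ∷ []) ((a + (b + (1 + 0))) / 2) + binom₋₂ M (suc k)
    ≡⟨ cong (λ m → count (a ∷ b ∷ 1 ∷ []) m + binom₋₂ M (suc k)) size ⟩
  count (a ∷ b ∷ 1 ∷ []) (suc M) + binom₋₂ M (suc k)
    ≡⟨ count-3rows k e a≡ b≡ refl ⟩
  binom M (suc k) ∎
  where
  open ≡-Reasoning
  D = double k
  E = double e
  M = suc (D + e)
  a = 2 * suc M ∸ 2 * suc k
  b = 2 * suc k ∸ 1
  twice-top : 2 * suc M ≡ suc (suc (D + E)) + 2 * suc k
  twice-top rewrite double≡+ k | double≡+ e = arith k e
    where arith : ∀ k e → 2 * suc (suc (k + k + e)) ≡ suc (suc (k + k + (e + e))) + 2 * suc k
          arith = solve-∀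
  twice-row : 2 * suc k ≡ 1 + suc D
  twice-row rewrite double≡+ k = arith k
    where arith : ∀ k → 2 * suc k ≡ 1 + suc (k + k)
          arith = solve-∀
  a≡ : a ≡ suc (suc (D + E))
  a≡ = trans (cong (_∸ 2 * suc k) twice-top) (m+n∸n≡m _ (2 * suc k))
  b≡ : b ≡ suc D
  b≡ = trans (cong (_∸ 1) twice-row) (m+n∸m≡n 1 (suc D))
  cells : suc (suc (D + E)) + (suc D + (1 + 0)) ≡ double (suc M)
  cells rewrite double≡+ (suc M) | double≡+ k | double≡+ e = arith k e
    where arith : ∀ k e → suc (suc (k + k + (e + e))) + (suc (k + k) + (1 + 0))
                          ≡ suc (suc (k + k + e)) + suc (suc (k + k + e))
          arith = solve-∀
  size : (a + (b + (1 + 0))) / 2 ≡ suc M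
  size = begin
    (a + (b + (1 + 0))) / 2                         ≡⟨ cong₂ (λ x y → (x + (y + (1 + 0))) / 2) a≡ b≡ ⟩
    (suc (suc (D + E)) + (suc D + (1 + 0))) / 2     ≡⟨ cong (_/ 2) cells ⟩
    double (suc M) / 2                              ≡⟨ double/2 (suc M) ⟩
    suc M                                           ∎

f₂-3rows : ∀ {m k} → suc k ≤ half (suc m) →
  f₂ (2 * suc m ∸ 2 * suc k ∷ 2 * suc k ∸ 1 ∷ 1 ∷ []) + binom₋₂ m (suc k) ≡ binom m (suc k)
f₂-3rows {m} {k} i≤half with m ∸ suc (double k) | m+[n∸m]≡n 2k+1≤m
  where 2k+1≤m : suc (double k) ≤ m
        2k+1≤m = ≤-pred (≤-trans (double-mono-≤ i≤half) (double-half≤ (suc m)))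
... | e | refl = f₂-3rows′ k e

∑-squares-2rows : ∀ n →
  sum (map (λ k → f₂ ((2 * n ∸ k) ∷ k ∷ []) * f₂ ((2 * n ∸ k) ∷ k ∷ [])) (upTo (suc n))) ≡ (2 * n) C n
∑-squares-2rows n = begin
  sum (map (λ k → f₂ (2 * n ∸ k ∷ k ∷ []) * f₂ (2 * n ∸ k ∷ k ∷ [])) (upTo (suc n)))
    ≡⟨ ∑-upTo (suc n) _ ⟩
  ∑[ k < suc n ] (f₂ (2 * n ∸ k ∷ k ∷ []) * f₂ (2 * n ∸ k ∷ k ∷ []))
    ≡⟨ ∑-cong (suc n) (λ k k≤n → cong₂ _*_ (f₂-2rows (≤-pred k≤n)) (f₂-2rows (≤-pred k≤n))) ⟩
  ∑[ k < suc n ] (binom n (half k) * binom n (half k))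
    ≡⟨ ∑-half n (λ j → binom n j * binom n j) (λ j j≤n → cong₂ _*_ (binom-reflect j≤n) (binom-reflect j≤n)) ⟩
  ∑[ j < suc n ] (binom n j * binom n j)
    ≡⟨ ∑-binom² n ⟩
  binom (n + n) n
    ≡⟨ cong (λ m → binom (n + m) n) (sym (+-identityʳ n)) ⟩
  binom (2 * n) n
    ≡⟨ binom≡C (2 * n) n ⟩
  (2 * n) C n ∎
  where open ≡-Reasoning

∣-∣-square : ∀ a b → ∣ a - b ∣ * ∣ a - b ∣ + (a * b + a * b) ≡ a * a + b * b
∣-∣-square a b with ≤-total a b
... | inj₁ a≤b with b ∸ a | m+[n∸m]≡n a≤b
...   | d | refl rewrite ∣m-m+n∣≡n a d = identity a d
  where identity : ∀ a d → d * d + (a * (a + d) + a * (a + d)) ≡ a * a + (a + d) * (a + d)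
        identity = solve-∀
∣-∣-square a b | inj₂ b≤a with a ∸ b | m+[n∸m]≡n b≤a
...   | d | refl rewrite ∣-∣-comm (b + d) b | ∣m-m+n∣≡n b d = identity b d
  where identity : ∀ b d → d * d + ((b + d) * b + (b + d) * b) ≡ (b + d) * (b + d) + b * b
        identity = solve-∀

+⇒≡∣-∣ : ∀ {x y z} → x + y ≡ z → x ≡ ∣ z - y ∣
+⇒≡∣-∣ {x} {y} refl =
  sym (trans (∣-∣-comm (x + y) y) (trans (cong (∣ y -_∣) (+-comm x y)) (∣m-m+n∣≡n y x)))

gap : ℕ → ℕ → ℕ
gap m i = ∣ binom m i - binom₋₂ m i ∣

gap-palindrome : ∀ m i → i ≤ suc (suc m) → gap m (suc (suc m) ∸ i) ≡ gap m i
gap-palindrome m i i≤N = begin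
  ∣ binom m (N ∸ i) - binom₋₂ m (N ∸ i) ∣
    ≡⟨ cong₂ ∣_-_∣ (sym (binom₋₂-reflect m i i≤N)) (binom₋₂-reflect m (N ∸ i) (m∸n≤m N i)) ⟩
  ∣ binom₋₂ m i - binom m (N ∸ (N ∸ i)) ∣
    ≡⟨ cong (λ j → ∣ binom₋₂ m i - binom m j ∣) (m∸[m∸n]≡n i≤N) ⟩
  ∣ binom₋₂ m i - binom m i ∣
    ≡⟨ ∣-∣-comm (binom₋₂ m i) (binom m i) ⟩
  gap m i ∎
  where
  open ≡-Reasoning
  N = suc (suc m)

gap-middle : ∀ m i → i + i ≡ suc (suc m) → gap m i ≡ 0
gap-middle m i i+i≡N = m≡n⇒∣m-n∣≡0 (sym (trans (binom₋₂-reflect m i i≤N) (cong (binom m) N∸i≡i)))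
  where
  i≤N = subst (i ≤_) i+i≡N (m≤m+n i i)
  N∸i≡i = trans (cong (_∸ i) (sym i+i≡N)) (m+n∸n≡m i i)

f₂≡gap : ∀ {m k} → suc k ≤ half (suc m) →
  f₂ (2 * suc m ∸ 2 * suc k ∷ 2 * suc k ∸ 1 ∷ 1 ∷ []) ≡ gap m (suc k)
f₂≡gap i≤half = +⇒≡∣-∣ (f₂-3rows i≤half)

∑-gap² : ∀ m → ∑[ i < suc (suc (suc m)) ] (gap m i * gap m i)
                 + (binom (m + m) (suc (suc m)) + binom (m + m) (suc (suc m)))
               ≡ binom (m + m) m + binom (m + m) m
∑-gap² m = begin
  ∑ N gap² + (c₂ + c₂)
    ≡⟨ cong (λ v → ∑ N gap² + (v + v)) (sym ∑-cross) ⟩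
  ∑ N gap² + (∑ N cross + ∑ N cross)
    ≡⟨ trans (cong (∑ N gap² +_) (sym (∑-+ N cross cross))) (sym (∑-+ N gap² (λ i → cross i + cross i))) ⟩
  ∑[ i < N ] (gap² i + (cross i + cross i))
    ≡⟨ ∑-cong N (λ i _ → ∣-∣-square (binom m i) (binom₋₂ m i)) ⟩
  ∑[ i < N ] (binom m i * binom m i + binom₋₂ m i * binom₋₂ m i)
    ≡⟨ ∑-+ N (λ i → binom m i * binom m i) (λ i → binom₋₂ m i * binom₋₂ m i) ⟩
  ∑[ i < N ] (binom m i * binom m i) + ∑[ i < suc m ] (binom m i * binom m i)
    ≡⟨ cong₂ _+_ ∑-binom²-padded (∑-binom² m) ⟩
  c₀ + c₀ ∎
  where
  open ≡-Reasoning
  N = suc (suc (suc m))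
  c₂ = binom (m + m) (suc (suc m))
  c₀ = binom (m + m) m
  gap² cross : ℕ → ℕ
  gap² i = gap m i * gap m i
  cross i = binom m i * binom₋₂ m i
  square : ℕ → ℕ
  square i = binom m i * binom m i
  ∑-cross : ∑ N cross ≡ c₂
  ∑-cross = trans (∑-cong N λ i i<N → cong (binom m i *_) (binom₋₂-reflect m i (≤-pred i<N)))
                  (vandermonde m m (suc (suc m)))
  ∑-binom²-padded : ∑[ i < N ] (binom m i * binom m i) ≡ c₀
  ∑-binom²-padded = begin
    ∑[ i < N ] (binom m i * binom m i)
      ≡⟨ trans (∑-last (suc (suc m)) square) (cong (_+ square (suc (suc m))) (∑-last (suc m) square)) ⟩
    ∑[ i < suc m ] (binom m i * binom m i) + binom m (suc m) * binom m (suc m) + binom m (suc (suc m)) * binom m (suc (suc m))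
      ≡⟨ cong₂ (λ x y → ∑[ i < suc m ] (binom m i * binom m i) + x * x + y * y)
               (binom-above (n<1+n m)) (binom-above (m≤n⇒m≤1+n (n<1+n m))) ⟩
    ∑[ i < suc m ] (binom m i * binom m i) + 0 + 0
      ≡⟨ trans (+-identityʳ _) (+-identityʳ _) ⟩
    ∑[ i < suc m ] (binom m i * binom m i)
      ≡⟨ ∑-binom² m ⟩
    c₀ ∎

∑-gap²-half : ∀ m → ∑[ i < suc (half (suc m)) ] (gap m i * gap m i) + binom (m + m) (suc (suc m)) ≡ binom (m + m) m
∑-gap²-half m = +-double-injective (begin
  H + c₂ + (H + c₂)   ≡⟨ interchange H c₂ H c₂ ⟩
  H + H + (c₂ + c₂)   ≡⟨ cong (_+ (c₂ + c₂)) (sym folded) ⟩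
  ∑ N gap² + (c₂ + c₂) ≡⟨ ∑-gap² m ⟩
  c₀ + c₀             ∎)
  where
  open ≡-Reasoning
  N = suc (suc (suc m))
  c₂ = binom (m + m) (suc (suc m))
  c₀ = binom (m + m) m
  gap² : ℕ → ℕ
  gap² i = gap m i * gap m i
  H = ∑ (suc (half (suc m))) gap²
  interchange : ∀ w x y z → w + x + (y + z) ≡ w + y + (x + z)
  interchange = solve-∀
  folded : ∑ N gap² ≡ H + H
  folded = trans (∑-fold (suc (suc m)) gap²
                          (λ i i≤N → cong₂ _*_ (gap-palindrome m i i≤N) (gap-palindrome m i i≤N))
                          (λ i i+i≡N → cong (λ g → g * g) (gap-middle m i i+i≡N)))
                 (∑-+ (suc (half (suc m))) gap² gap²)

∑-gap²-catalan : ∀ m → ∑[ i < suc (half (suc m)) ] (gap m i * gap m i) * suc (suc m) ≡ binom (suc m + suc m) (suc m)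
∑-gap²-catalan m = +-cancelʳ-≡ (c₂ * suc (suc m)) _ _ (begin
  H * suc (suc m) + c₂ * suc (suc m) ≡⟨ sym (*-distribʳ-+ (suc (suc m)) H c₂) ⟩
  (H + c₂) * suc (suc m)             ≡⟨ cong (_* suc (suc m)) (∑-gap²-half m) ⟩
  binom (m + m) m * suc (suc m)      ≡⟨ catalan m ⟩
  binom (suc m + suc m) (suc m) + c₂ * suc (suc m) ∎)
  where
  open ≡-Reasoning
  H = ∑[ i < suc (half (suc m)) ] (gap m i * gap m i)
  c₂ = binom (m + m) (suc (suc m))

∑-squares-3rows : ∀ n →
  sum (map (λ k → f₂ ((2 * n ∸ 2 * k) ∷ (2 * k ∸ 1) ∷ 1 ∷ []) * f₂ ((2 * n ∸ 2 * k) ∷ (2 * k ∸ 1) ∷ 1 ∷ []))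
           (map suc (upTo (n / 2))))
    ≡ ((2 * n) C n) / suc n ∸ 1
∑-squares-3rows zero    = refl
∑-squares-3rows (suc m) = begin
  sum (map square (map suc (upTo (suc m / 2))))
    ≡⟨ cong sum (sym (map-∘ (upTo (suc m / 2)))) ⟩
  sum (map (square ∘ suc) (upTo (suc m / 2)))
    ≡⟨ ∑-upTo (suc m / 2) (square ∘ suc) ⟩
  ∑ (suc m / 2) (square ∘ suc)
    ≡⟨ cong (λ L → ∑ L (square ∘ suc)) (sym (half≡/2 (suc m))) ⟩
  ∑ (half (suc m)) (square ∘ suc)
    ≡⟨ ∑-cong (half (suc m)) (λ k k<half → cong₂ _*_ (f₂≡gap k<half) (f₂≡gap k<half)) ⟩
  H ∸ 1
    ≡⟨ cong (_∸ 1) (sym (m*n/n≡m H (suc (suc m)))) ⟩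
  H * suc (suc m) / suc (suc m) ∸ 1
    ≡⟨ cong (λ x → x / suc (suc m) ∸ 1) (∑-gap²-catalan m) ⟩
  binom (suc m + suc m) (suc m) / suc (suc m) ∸ 1
    ≡⟨ cong (λ x → x / suc (suc m) ∸ 1)
            (trans (cong (λ x → binom (suc m + x) (suc m)) (sym (+-identityʳ (suc m)))) (binom≡C (2 * suc m) (suc m))) ⟩
  ((2 * suc m) C suc m) / suc (suc m) ∸ 1 ∎
  where
  open ≡-Reasoning
  square : ℕ → ℕ
  square k = f₂ (2 * suc m ∸ 2 * k ∷ 2 * k ∸ 1 ∷ 1 ∷ []) * f₂ (2 * suc m ∸ 2 * k ∷ 2 * k ∸ 1 ∷ 1 ∷ [])
  H = ∑[ i < suc (half (suc m)) ] (gap m i * gap m i)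

corollary2p12 : (n : ℕ) →
    (sum (map (λ k → f₂ ((2 * n ∸ k) ∷ k ∷ []) * f₂ ((2 * n ∸ k) ∷ k ∷ [])) (upTo (suc n)))
      ≡ (2 * n) C n)
    × (sum (map (λ k → f₂ ((2 * n ∸ 2 * k) ∷ (2 * k ∸ 1) ∷ 1 ∷ []) * f₂ ((2 * n ∸ 2 * k) ∷ (2 * k ∸ 1) ∷ 1 ∷ []))
                (map suc (upTo (n / 2))))
      ≡ ((2 * n) C n) / suc n ∸ 1)
corollary2p12 n = ∑-squares-2rows n , ∑-squares-3rows n
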